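{- Let $t=(t_1,\dots,t_k)$ be a type, $s\in S^a$, $t'=(t_1,\dots,t_k,s)$, and let $A,B\in\tilde{\mathcal A}$. Then \[ L_{t'}(A,Bs)=\begin{cases} L_t(A,B) & \text{if } B\succ Bs,\\ q_sL_t(A,B)+(q_s-1)L_t(A,Bs) & \text{if } B\prec Bs.\end{cases} \]
   Context: $\Phi$ is a reduced root datum with finite Weyl group $W$, positive roots $\phi^+$, $V^*=X^\vee\otimes\mathbb R$. Alcoves are closures of components of $V^*\setminus\bigcup_{\alpha\in\phi^+,m\in\mathbb Z}\{\langle\alpha,x\rangle=m\}$; $A_f$ the fundamental alcove $\{0\le\langle\alpha,x\rangle\le1\}$. $\tilde W^a=W\ltimes X^\vee$, $W^a=W\ltimes Q^\vee$ Coxeter group with generators $S^a$ = reflections in walls of $A_f$, $\Omega$ the stabilizer of $A_f$. Generalized alcoves $\tilde{\mathcal A}=\{(A,\mu):\mu\in A\cap X^\vee\}$, $A_v=v\cdot(A_f,0)$, right action $A_vu=A_{vu}$. For $s\in S^a$: $A\prec As$ if the alcove of $A$ lies on the side $\langle\alpha,x\rangle\le m$ of the hyperplane $H_{\alpha,m}$ ($\alpha\in\phi^+$) containing the common face of $A$ and $As$, otherwise $A\succ As$. A type is $t=(t_1,\dots,t_k)$, $t_i\in S^a\cup\Omega$; a gallery of type $t$ connecting $A$ and $B$ is $(A=A_0,\dots,A_k=B)$ with $A_{i+1}=A_it_{i+1}$ if $t_{i+1}\in\Omega$, $A_{i+1}\in\{A_i,A_it_{i+1}\}$ if $t_{i+1}\in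 S^a$. Positive $s$-direction at $i$: $t_{i+1}=s$, $A_{i+1}=A_is$, $A_i\prec A_is$; $s$-fold at $i$: $t_{i+1}=s$, $A_{i+1}=A_i$, positive if $A_i\succ A_is$; positively folded: all folds positive. Parameters: $d:S^a\to\mathbb N$ invariant under $\tilde W^a$-conjugation, $q_s=q^{d(s)}$. $L_\sigma=\prod_{s\in S^a}q_s^{m_s(\sigma)}(q_s-1)^{n_s(\sigma)}$ where $m_s$ counts positive $s$-directions and $n_s$ counts $s$-folds. $\Gamma^+_t(A,B)$ is the set of positively folded galleries of type $t$ connecting $A$ and $B$, and $L_t(A,B)=\sum_{\sigma\in\Gamma^+_t(A,B)}L_\sigma$. -}

module Defs where

open import Data.Nat as ℕ using (ℕ)
open import Data.Integer as ℤ using (ℤ; +_)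
open import Data.Rational as ℚ using (ℚ; 0ℚ; 1ℚ; _/_)
open import Data.Fin as Fin using (Fin)
open import Data.Vec as Vec using (Vec; []; _∷_; zipWith; tabulate)
open import Data.Vec.Properties using (≡-dec)
open import Data.List as List using (List; []; _∷_; _++_)
open import Data.Product using (Σ; ∃; _×_; _,_)
open import Data.Sum using (_⊎_; inj₁; inj₂)
open import Data.Bool using (Bool; true; false; if_then_else_)
open import Relation.Nullary using (¬_; Dec; yes; no; _×-dec_)
open import Relation.Nullary.Decidable using (⌊_⌋)
open import Relation.Binary.PropositionalEquality using (_≡_; _≢_)

-- Linear algebra on X = ℤⁿ, X^∨ = ℤⁿ (standard pairing), V^* ⊇ ℚⁿ

dotℤ : ∀ {n} → Vec ℤ n → Vec ℤ n → ℤ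
dotℤ []       []       = + 0
dotℤ (a ∷ x) (b ∷ y) = a ℤ.* b ℤ.+ dotℤ x y

ιℚ : ℤ → ℚ
ιℚ z = z / 1

dotℚ : ∀ {n} → Vec ℤ n → Vec ℚ n → ℚ
dotℚ []       []       = 0ℚ
dotℚ (a ∷ α) (x ∷ y) = ιℚ a ℚ.* x ℚ.+ dotℚ α y

_+ᶻ_ : ∀ {n} → Vec ℤ n → Vec ℤ n → Vec ℤ n
_+ᶻ_ = zipWith ℤ._+_

_-ᶻ_ : ∀ {n} → Vec ℤ n → Vec ℤ n → Vec ℤ n
_-ᶻ_ = zipWith ℤ._-_

_·ᶻ_ : ∀ {n} → ℤ → Vec ℤ n → Vec ℤ n
c ·ᶻ v = Vec.map (c ℤ.*_) v

ιᵥ : ∀ {n} → Vec ℤ n → Vec ℚ n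
ιᵥ = Vec.map ιℚ

_+ᵠ_ : ∀ {n} → Vec ℚ n → Vec ℚ n → Vec ℚ n
_+ᵠ_ = zipWith ℚ._+_

_-ᵠ_ : ∀ {n} → Vec ℚ n → Vec ℚ n → Vec ℚ n
_-ᵠ_ = zipWith ℚ._-_

_·ᵠ_ : ∀ {n} → ℚ → Vec ℚ n → Vec ℚ n
c ·ᵠ v = Vec.map (c ℚ.*_) v

basis : ∀ {n} → Fin n → Vec ℤ n
basis j = tabulate (λ i → if ⌊ i Fin.≟ j ⌋ then + 1 else + 0)

-- Reduced root datum (X = ℤⁿ, X^∨ = ℤⁿ, standard perfect pairing),
-- roots indexed by Fin N, with the bijection α ↦ α^∨ given by the index.

record RootDatum : Set where
  field
    n N      : ℕ
    root     : Fin N → Vec ℤ n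
    coroot   : Fin N → Vec ℤ n
    root-inj   : ∀ i j → root i ≡ root j → i ≡ j
    coroot-inj : ∀ i j → coroot i ≡ coroot j → i ≡ j
    pair-two   : ∀ i → dotℤ (root i) (coroot i) ≡ + 2
    root-refl   : ∀ i j → ∃ λ k →
      root j -ᶻ (dotℤ (root j) (coroot i) ·ᶻ root i) ≡ root k
    coroot-refl : ∀ i j → ∃ λ k →
      coroot j -ᶻ (dotℤ (root i) (coroot j) ·ᶻ coroot i) ≡ coroot k
    reduced : ∀ i j → root j ≢ ((+ 2) ·ᶻ root i)

-- A system of positive roots: φ⁺ = {α : ⟨α, ξ⟩ > 0} for a regular ξ ∈ X^∨.
record PosSystem (R : RootDatum) : Set where
  open RootDatum R
  field
    ξ       : Vec ℤ n
    regular : ∀ i → dotℤ (root i) ξ ≢ + 0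

module Setup (R : RootDatum) (P : PosSystem R) where
  open RootDatum R public
  open PosSystem P public

  Positive : Fin N → Set
  Positive i = + 0 ℤ.< dotℤ (root i) ξ

  ⟨_,_⟩ : Fin N → Vec ℚ n → ℚ
  ⟨ i , x ⟩ = dotℚ (root i) x

  reflℚ : Fin N → Vec ℚ n → Vec ℚ n
  reflℚ i x = x -ᵠ (⟨ i , x ⟩ ·ᵠ ιᵥ (coroot i))

  reflℤ : Fin N → Vec ℤ n → Vec ℤ n
  reflℤ i x = x -ᶻ (dotℤ (root i) x ·ᶻ coroot i)

  -- elements of W are products of reflections (words); act from the right end
  actℚ : List (Fin N) → Vec ℚ n → Vec ℚ n
  actℚ []      x = x
  actℚ (i ∷ w) x = reflℚ i (actℚ w x)

  actℤ : List (Fin N) → Vec ℤ n → Vec ℤ n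
  actℤ []      x = x
  actℤ (i ∷ w) x = reflℤ i (actℤ w x)

  -- element of W̃^a = W ⋉ X^∨ : x ↦ w x + λ
  record Aff : Set where
    constructor aff
    field
      word  : List (Fin N)
      trans : Vec ℤ n
  open Aff public

  apply : Aff → Vec ℚ n → Vec ℚ n
  apply v x = actℚ (word v) x +ᵠ ιᵥ (trans v)

  _∙_ : Aff → Aff → Aff
  v ∙ u = aff (word v ++ word u) (trans v +ᶻ actℤ (word v) (trans u))

  linMat : Aff → Vec (Vec ℤ n) n
  linMat v = tabulate (λ j → actℤ (word v) (basis j))

  -- equality in W̃^a (= equality of generalized alcoves A_v = A_u)
  _≈_ : Aff → Aff → Set
  v ≈ u = (linMat v ≡ linMat u) × (trans v ≡ trans u)

  _≈?_ : (v u : Aff) → Dec (v ≈ u)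
  v ≈? u = ≡-dec (≡-dec ℤ._≟_) (linMat v) (linMat u)
           ×-dec ≡-dec ℤ._≟_ (trans v) (trans u)

  InAf : Vec ℚ n → Set
  InAf x = ∀ i → Positive i → (0ℚ ℚ.≤ ⟨ i , x ⟩) × (⟨ i , x ⟩ ℚ.≤ 1ℚ)

  IsWall : Fin N → ℤ → Set
  IsWall i m = Positive i × ∃ λ x → InAf x × (⟨ i , x ⟩ ≡ ιℚ m)
             × (∀ j → Positive j → j ≢ i → ∀ k → ⟨ j , x ⟩ ≢ ιℚ k)

  Sa : Set
  Sa = Σ (Fin N × ℤ) (λ { (i , m) → IsWall i m })

  -- s_{α,m} : x ↦ x - (⟨α,x⟩ - m) α^∨  =  t_{m α^∨} s_α
  sElem : Sa → Aff
  sElem ((i , m) , _) = aff (i ∷ []) (m ·ᶻ coroot i)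

  Omega : Set
  Omega = Σ Aff λ v → (∀ x → InAf x → InAf (apply v x))
                    × (∀ y → InAf y → ∃ λ x → InAf x × apply v x ≡ y)

  Letter : Set
  Letter = Sa ⊎ Omega

  Type : Set
  Type = List Letter

  -- A_v ≺ A_v s : the alcove v·A_f lies on the side ⟨α,x⟩ ≤ m (α ∈ φ⁺) of
  -- the hyperplane H_{α,m} containing the common face v(A_f ∩ H_s).
  Prec : Aff → Sa → Set
  Prec v s = ∃ λ j → Positive j × ∃ λ (m : ℤ) →
      (∀ x → InAf x → apply (sElem s) x ≡ x → ⟨ j , apply v x ⟩ ≡ ιℚ m)
    × (∀ x → InAf x → ⟨ j , apply v x ⟩ ℚ.≤ ιℚ m)

  record Params : Set where
    field
      d   : Sa → ℕ
      inv : ∀ s s' (v : Aff) →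
            (∀ x → apply v (apply (sElem s) x) ≡ apply (sElem s') (apply v x)) →
            d s ≡ d s'

  -- Galleries of type t starting at A are determined by choosing, at each
  -- S^a-letter, whether to cross (A_{i+1} = A_i s) or fold (A_{i+1} = A_i).
  data Step : Set where
    cross fold : Step

  data Choice : Type → Set where
    []  : Choice []
    ω∷_ : ∀ {o t} → Choice t → Choice (inj₂ o ∷ t)
    _s∷_ : ∀ {s t} → Step → Choice t → Choice (inj₁ s ∷ t)

  allChoices : (t : Type) → List (Choice t)
  allChoices []           = [] ∷ []
  allChoices (inj₂ o ∷ t) = List.map ω∷_ (allChoices t)
  allChoices (inj₁ s ∷ t) =
    List.map (cross s∷_) (allChoices t) ++ List.map (fold s∷_) (allChoices t)

  gallery : Aff → (t : Type) → Choice t → List Aff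
  gallery A []            []          = A ∷ []
  gallery A (inj₂ o ∷ t)  (ω∷ c)      = A ∷ gallery (A ∙ Data.Product.proj₁ o) t c
  gallery A (inj₁ s ∷ t)  (cross s∷ c) = A ∷ gallery (A ∙ sElem s) t c
  gallery A (inj₁ s ∷ t)  (fold s∷ c)  = A ∷ gallery A t c

  -- The module below needs a decision procedure for ≺ (which exists
  -- classically; any two give the same answers) and the value of q.
  module Weights (prm : Params) (dec : ∀ v s → Dec (Prec v s)) (q : ℤ) where
    open Params prm

    qs : Sa → ℤ
    qs s = q ℤ.^ d s

    -- contribution of the gallery (A, t, c): L_σ if σ is positively folded
    -- and ends at B, and 0 otherwise.  L_σ is the product over the steps
    -- of q_s (positive s-direction), 1 (negative s-direction),
    -- q_s - 1 (s-fold), 1 (Ω-step) = ∏_s q_s^{m_s}(q_s-1)^{n_s}.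
    contrib : Aff → (t : Type) → Choice t → Aff → ℤ
    contrib A []            []           B = if ⌊ A ≈? B ⌋ then + 1 else + 0
    contrib A (inj₂ o ∷ t)  (ω∷ c)       B = contrib (A ∙ Data.Product.proj₁ o) t c B
    contrib A (inj₁ s ∷ t)  (cross s∷ c) B =
      (if ⌊ dec A s ⌋ then qs s else + 1) ℤ.* contrib (A ∙ sElem s) t c B
    contrib A (inj₁ s ∷ t)  (fold s∷ c)  B =
      (if ⌊ dec A s ⌋ then + 0 else (qs s ℤ.- + 1)) ℤ.* contrib A t c B

    sumℤ : List ℤ → ℤ
    sumℤ = List.foldr ℤ._+_ (+ 0)

    L : Type → Aff → Aff → ℤ
    L t A B = sumℤ (List.map (λ c → contrib A t c B) (allChoices t))

module Submission where

-- Splitting off the last letter, a gallery of type t·s ending at Bs is a gallery of type t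
-- ending at some E followed by either a crossing E → Es, so E = B, or a fold at E, so E = Bs.
-- Hence L_{t·s}(A, Bs) = c · L_t(A, B) + f · L_t(A, Bs), where c = q_s if B ≺ Bs and 1
-- otherwise, and f = 0 if Bs ≺ Bss = B and q_s - 1 otherwise.  The formula follows once
-- exactly one of B ≺ Bs and Bs ≺ B is known to hold.
--
-- The linear part w of B pulls some positive root α_k back to ±α_i, so ⟨α_k, B x⟩ =
-- M ± (⟨α_i, x⟩ - m) is constant on the wall and of constant sign on A_f: it witnesses
-- B ≺ Bs or Bs ≺ B.  Conversely, a witnessing root is integral at B x₀ for the generic wall
-- point x₀, so it too pulls back to ±α_i, with the sign forced by its positivity.  Witnesses
-- for both B ≺ Bs and Bs ≺ B would then put A_f on both sides of the wall, i.e. inside it.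

open import Defs
open import Data.Nat as ℕ using (zero; suc)
open import Data.Integer as ℤ using (ℤ; -[1+_]; 1ℤ; -1ℤ)
import Data.Integer.Properties as ℤP
open import Data.Integer.Tactic.RingSolver as ℤ-Solver using ()
open import Data.Vec as Vec using (Vec; []; _∷_)
import Data.Vec.Properties as VecP
open import Data.Fin as Fin using (Fin; zero; suc)
open import Relation.Nullary using (¬_; Dec; yes; no)
import Relation.Nullary.Decidable as Decidable
open import Relation.Nullary.Decidable using (⌊_⌋)
open import Data.Bool using (if_then_else_)
open import Function using (_∘_; case_of_; _⇔_; mk⇔)
open import Data.Product using (∃; _×_; _,_; proj₁; proj₂)
open import Data.Sum as Sum using (_⊎_; inj₁; inj₂; [_,_]′)
open import Data.Empty using (⊥; ⊥-elim)
open import Relation.Binary.PropositionalEquality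
open import Relation.Binary using (tri<; tri≈; tri>)

module Rational where

  open import Data.Rational using (ℚ; mkℚ; 0ℚ; 1ℚ; _+_; _*_; _-_; -_; 1/_; _⊓_; _≤_; _<_; *≤*; *<*; ↥_;
    ½; Positive; NonZero; positive; nonNegative)
  import Data.Rational.Properties as ℚP
  import Data.Nat.Coprimality as Coprimality
  open import Data.Maybe.Base using (Maybe; just; nothing)
  open import Level using (0ℓ)
  import Tactic.RingSolver as RingSolver
  open import Tactic.RingSolver.Core.AlmostCommutativeRing using (AlmostCommutativeRing; fromCommutativeRing)

  ℚ-ring : AlmostCommutativeRing 0ℓ 0ℓ
  ℚ-ring = fromCommutativeRing ℚP.+-*-commutativeRing isZero
    where
    isZero : ∀ p → Maybe (0ℚ ≡ p)
    isZero p with 0ℚ ℚP.≟ p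
    ... | yes 0≡p = just 0≡p
    ... | no _    = nothing

  -- a / 1 unfolds to fromℚᵘ (mkℚᵘ a 0), which fromℚᵘ-toℚᵘ identifies with the normal form fromℤ a.
  private
    fromℤ : ℤ → ℚ
    fromℤ a = mkℚ a 0 (Coprimality.sym (Coprimality.1-coprimeTo _))

    ιℚ≡fromℤ : ∀ a → ιℚ a ≡ fromℤ a
    ιℚ≡fromℤ a = ℚP.fromℚᵘ-toℚᵘ (fromℤ a)

    -fromℤ : ∀ a → - fromℤ a ≡ fromℤ (ℤ.- a)
    -fromℤ (ℤ.+ zero)  = refl
    -fromℤ (ℤ.+ suc n) = refl
    -fromℤ -[1+ n ]  = refl

  ιℚ-+ : ∀ a b → ιℚ (a ℤ.+ b) ≡ ιℚ a + ιℚ b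
  ιℚ-+ a b rewrite ιℚ≡fromℤ a | ιℚ≡fromℤ b = cong ιℚ (by-ring a b)
    where by-ring : ∀ a b → a ℤ.+ b ≡ a ℤ.* 1ℤ ℤ.+ b ℤ.* 1ℤ
          by-ring = ℤ-Solver.solve-∀

  ιℚ-* : ∀ a b → ιℚ (a ℤ.* b) ≡ ιℚ a * ιℚ b
  ιℚ-* a b rewrite ιℚ≡fromℤ a | ιℚ≡fromℤ b = refl

  ιℚ-neg : ∀ a → ιℚ (ℤ.- a) ≡ - ιℚ a
  ιℚ-neg a rewrite ιℚ≡fromℤ a | ιℚ≡fromℤ (ℤ.- a) = sym (-fromℤ a)

  ιℚ-- : ∀ a b → ιℚ (a ℤ.- b) ≡ ιℚ a - ιℚ b
  ιℚ-- a b = trans (ιℚ-+ a (ℤ.- b)) (cong (ιℚ a +_) (ιℚ-neg b))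

  ιℚ-injective : ∀ {a b} → ιℚ a ≡ ιℚ b → a ≡ b
  ιℚ-injective {a} {b} eq rewrite ιℚ≡fromℤ a | ιℚ≡fromℤ b = cong ↥_ eq

  ιℚ-cancel-≤ : ∀ {a b} → ιℚ a ≤ ιℚ b → a ℤ.≤ b
  ιℚ-cancel-≤ {a} {b} le rewrite ιℚ≡fromℤ a | ιℚ≡fromℤ b with le
  ... | *≤* a≤b = subst₂ ℤ._≤_ (ℤP.*-identityʳ a) (ℤP.*-identityʳ b) a≤b

  ιℚ-mono-< : ∀ {a b} → a ℤ.< b → ιℚ a < ιℚ b
  ιℚ-mono-< {a} {b} a<b rewrite ιℚ≡fromℤ a | ιℚ≡fromℤ b =
    *<* (subst₂ ℤ._<_ (sym (ℤP.*-identityʳ a)) (sym (ℤP.*-identityʳ b)) a<b)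

  InUnit : ℚ → Set
  InUnit y = 0ℚ ≤ y × y ≤ 1ℚ

  0ᵥ : ∀ {k} → Vec ℚ k
  0ᵥ = Vec.replicate _ 0ℚ

  dot-+ : ∀ {k} (α : Vec ℤ k) x y → dotℚ α (x +ᵠ y) ≡ dotℚ α x + dotℚ α y
  dot-+ []      []       []       = refl
  dot-+ (a ∷ α) (x ∷ xs) (y ∷ ys) = trans (cong (ιℚ a * (x + y) +_) (dot-+ α xs ys)) (by-ring (ιℚ a) x y _ _)
    where by-ring : ∀ a x y u v → a * (x + y) + (u + v) ≡ (a * x + u) + (a * y + v)
          by-ring = RingSolver.solve-∀ ℚ-ring

  dot-· : ∀ {k} (α : Vec ℤ k) c x → dotℚ α (c ·ᵠ x) ≡ c * dotℚ α x
  dot-· []      c []       = sym (ℚP.*-zeroʳ c)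
  dot-· (a ∷ α) c (x ∷ xs) = trans (cong (ιℚ a * (c * x) +_) (dot-· α c xs)) (by-ring (ιℚ a) c x _)
    where by-ring : ∀ a c x u → a * (c * x) + c * u ≡ c * (a * x + u)
          by-ring = RingSolver.solve-∀ ℚ-ring

  dot-- : ∀ {k} (α : Vec ℤ k) x y → dotℚ α (x -ᵠ y) ≡ dotℚ α x - dotℚ α y
  dot-- []      []       []       = refl
  dot-- (a ∷ α) (x ∷ xs) (y ∷ ys) = trans (cong (ιℚ a * (x - y) +_) (dot-- α xs ys)) (by-ring (ιℚ a) x y _ _)
    where by-ring : ∀ a x y u v → a * (x - y) + (u - v) ≡ (a * x + u) - (a * y + v)
          by-ring = RingSolver.solve-∀ ℚ-ring

  dot-ιᵥ : ∀ {k} (α β : Vec ℤ k) → dotℚ α (ιᵥ β) ≡ ιℚ (dotℤ α β)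
  dot-ιᵥ []      []      = refl
  dot-ιᵥ (a ∷ α) (b ∷ β) = begin
    ιℚ a * ιℚ b + dotℚ α (ιᵥ β)   ≡⟨ cong₂ _+_ (sym (ιℚ-* a b)) (dot-ιᵥ α β) ⟩
    ιℚ (a ℤ.* b) + ιℚ (dotℤ α β)  ≡⟨ sym (ιℚ-+ (a ℤ.* b) _) ⟩
    ιℚ (a ℤ.* b ℤ.+ dotℤ α β)     ∎
    where open ≡-Reasoning

  dot-0ᵥ : ∀ {k} (α : Vec ℤ k) → dotℚ α 0ᵥ ≡ 0ℚ
  dot-0ᵥ []      = refl
  dot-0ᵥ (a ∷ α) = trans (cong (ιℚ a * 0ℚ +_) (dot-0ᵥ α)) (by-ring (ιℚ a))
    where by-ring : ∀ a → a * 0ℚ + 0ℚ ≡ 0ℚ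
          by-ring = RingSolver.solve-∀ ℚ-ring

  dot-combˡ : ∀ {k} (α β : Vec ℤ k) c x → dotℚ (α -ᶻ (c ·ᶻ β)) x ≡ dotℚ α x - ιℚ c * dotℚ β x
  dot-combˡ []      []      c []       = by-ring (ιℚ c)
    where by-ring : ∀ c → 0ℚ ≡ 0ℚ - c * 0ℚ
          by-ring = RingSolver.solve-∀ ℚ-ring
  dot-combˡ (a ∷ α) (b ∷ β) c (x ∷ xs) = begin
    ιℚ (a ℤ.- c ℤ.* b) * x + dotℚ (α -ᶻ (c ·ᶻ β)) xs
      ≡⟨ cong₂ (λ u v → u * x + v) (trans (ιℚ-- a (c ℤ.* b)) (cong (λ u → ιℚ a - u) (ιℚ-* c b)))
                                    (dot-combˡ α β c xs) ⟩
    (ιℚ a - ιℚ c * ιℚ b) * x + (dotℚ α xs - ιℚ c * dotℚ β xs)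
      ≡⟨ by-ring (ιℚ a) (ιℚ b) (ιℚ c) x _ _ ⟩
    (ιℚ a * x + dotℚ α xs) - ιℚ c * (ιℚ b * x + dotℚ β xs) ∎
    where open ≡-Reasoning
          by-ring : ∀ a b c x u v → (a - c * b) * x + (u - c * v) ≡ (a * x + u) - c * (b * x + v)
          by-ring = RingSolver.solve-∀ ℚ-ring

  ιᵥ-+ : ∀ {k} (x y : Vec ℤ k) → ιᵥ (x +ᶻ y) ≡ ιᵥ x +ᵠ ιᵥ y
  ιᵥ-+ []       []       = refl
  ιᵥ-+ (x ∷ xs) (y ∷ ys) = cong₂ _∷_ (ιℚ-+ x y) (ιᵥ-+ xs ys)

  ιᵥ-- : ∀ {k} (x y : Vec ℤ k) → ιᵥ (x -ᶻ y) ≡ ιᵥ x -ᵠ ιᵥ y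
  ιᵥ-- []       []       = refl
  ιᵥ-- (x ∷ xs) (y ∷ ys) = cong₂ _∷_ (ιℚ-- x y) (ιᵥ-- xs ys)

  ιᵥ-· : ∀ {k} c (x : Vec ℤ k) → ιᵥ (c ·ᶻ x) ≡ ιℚ c ·ᵠ ιᵥ x
  ιᵥ-· c []       = refl
  ιᵥ-· c (x ∷ xs) = cong₂ _∷_ (ιℚ-* c x) (ιᵥ-· c xs)

  ιᵥ-0 : ∀ k → ιᵥ (Vec.replicate k (ℤ.+ 0)) ≡ 0ᵥ
  ιᵥ-0 zero    = refl
  ιᵥ-0 (suc k) = cong (0ℚ ∷_) (ιᵥ-0 k)

  ιᵥ-injective : ∀ {k} {x y : Vec ℤ k} → ιᵥ x ≡ ιᵥ y → x ≡ y
  ιᵥ-injective {x = []}     {[]}     eq = refl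
  ιᵥ-injective {x = a ∷ x} {b ∷ y} eq =
    cong₂ _∷_ (ιℚ-injective (VecP.∷-injectiveˡ eq)) (ιᵥ-injective (VecP.∷-injectiveʳ eq))

  ·ᵠ-zeroˡ : ∀ {k} (x : Vec ℚ k) → 0ℚ ·ᵠ x ≡ 0ᵥ
  ·ᵠ-zeroˡ x = trans (VecP.map-cong ℚP.*-zeroˡ x) (VecP.map-const x 0ℚ)

  ·ᵠ-zeroʳ : ∀ {k} a → a ·ᵠ 0ᵥ {k} ≡ 0ᵥ
  ·ᵠ-zeroʳ {k} a = trans (VecP.map-replicate (a *_) 0ℚ k) (cong (Vec.replicate k) (ℚP.*-zeroʳ a))

  +ᵠ-identityˡ : ∀ {k} (x : Vec ℚ k) → 0ᵥ +ᵠ x ≡ x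
  +ᵠ-identityˡ = VecP.zipWith-identityˡ ℚP.+-identityˡ

  +ᵠ-cancelʳ : ∀ {k} (x y z : Vec ℚ k) → x +ᵠ z ≡ y +ᵠ z → x ≡ y
  +ᵠ-cancelʳ []       []       []       eq = refl
  +ᵠ-cancelʳ (x ∷ xs) (y ∷ ys) (z ∷ zs) eq =
    cong₂ _∷_ (cancel (VecP.∷-injectiveˡ eq)) (+ᵠ-cancelʳ xs ys zs (VecP.∷-injectiveʳ eq))
    where
    cancel : x + z ≡ y + z → x ≡ y
    cancel eq = trans (by-ring x z) (trans (cong (_- z) eq) (sym (by-ring y z)))
      where by-ring : ∀ x z → x ≡ (x + z) - z
            by-ring = RingSolver.solve-∀ ℚ-ring

  +ᵠ-swapʳ : ∀ {k} (x y z : Vec ℚ k) → x +ᵠ (y +ᵠ z) ≡ (x +ᵠ z) +ᵠ y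
  +ᵠ-swapʳ []       []       []       = refl
  +ᵠ-swapʳ (x ∷ xs) (y ∷ ys) (z ∷ zs) = cong₂ _∷_ (by-ring x y z) (+ᵠ-swapʳ xs ys zs)
    where by-ring : ∀ x y z → x + (y + z) ≡ (x + z) + y
          by-ring = RingSolver.solve-∀ ℚ-ring

  -ᵠ-·ᵠ-+ : ∀ {k} (x c : Vec ℚ k) a b → (x -ᵠ (a ·ᵠ c)) -ᵠ (b ·ᵠ c) ≡ x -ᵠ ((a + b) ·ᵠ c)
  -ᵠ-·ᵠ-+ []       []       a b = refl
  -ᵠ-·ᵠ-+ (x ∷ xs) (c ∷ cs) a b = cong₂ _∷_ (by-ring x c a b) (-ᵠ-·ᵠ-+ xs cs a b)
    where by-ring : ∀ x c a b → (x - a * c) - b * c ≡ x - (a + b) * c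
          by-ring = RingSolver.solve-∀ ℚ-ring

  -ᵠ-·ᵠ-0 : ∀ {k} (x c : Vec ℚ k) → x -ᵠ (0ℚ ·ᵠ c) ≡ x
  -ᵠ-·ᵠ-0 []       []       = refl
  -ᵠ-·ᵠ-0 (x ∷ xs) (c ∷ cs) = cong₂ _∷_ (by-ring x c) (-ᵠ-·ᵠ-0 xs cs)
    where by-ring : ∀ x c → x - 0ℚ * c ≡ x
          by-ring = RingSolver.solve-∀ ℚ-ring

  reflection-involutive : ∀ {k} (F : Vec ℚ k → Vec ℚ k) (φ : Vec ℚ k → ℚ) (c : Vec ℚ k) →
                          (∀ x → F x ≡ x -ᵠ (φ x ·ᵠ c)) → (∀ x → φ (F x) ≡ - φ x) → ∀ x → F (F x) ≡ x
  reflection-involutive F φ c F≡ φ∘F x = begin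
    F (F x)                                  ≡⟨ F≡ (F x) ⟩
    F x -ᵠ (φ (F x) ·ᵠ c)                    ≡⟨ cong₂ (λ u a → u -ᵠ (a ·ᵠ c)) (F≡ x) (φ∘F x) ⟩
    (x -ᵠ (φ x ·ᵠ c)) -ᵠ ((- φ x) ·ᵠ c)      ≡⟨ -ᵠ-·ᵠ-+ x c (φ x) (- φ x) ⟩
    x -ᵠ ((φ x + - φ x) ·ᵠ c)                ≡⟨ cong (λ a → x -ᵠ (a ·ᵠ c)) (ℚP.+-inverseʳ (φ x)) ⟩
    x -ᵠ (0ℚ ·ᵠ c)                           ≡⟨ -ᵠ-·ᵠ-0 x c ⟩
    x                                        ∎
    where open ≡-Reasoning

  -ᵠ-·ᵠ-+ᵠ-·ᵠ : ∀ {k} (x c : Vec ℚ k) a b → (x -ᵠ (a ·ᵠ c)) +ᵠ (b ·ᵠ c) ≡ x -ᵠ ((a - b) ·ᵠ c)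
  -ᵠ-·ᵠ-+ᵠ-·ᵠ []       []       a b = refl
  -ᵠ-·ᵠ-+ᵠ-·ᵠ (x ∷ xs) (c ∷ cs) a b = cong₂ _∷_ (by-ring x c a b) (-ᵠ-·ᵠ-+ᵠ-·ᵠ xs cs a b)
    where by-ring : ∀ x c a b → (x - a * c) + b * c ≡ x - (a - b) * c
          by-ring = RingSolver.solve-∀ ℚ-ring

  -ᵠ-·ᵠ-distrib-+ᵠ : ∀ {k} (x y c : Vec ℚ k) a b →
                    (x +ᵠ y) -ᵠ ((a + b) ·ᵠ c) ≡ (x -ᵠ (a ·ᵠ c)) +ᵠ (y -ᵠ (b ·ᵠ c))
  -ᵠ-·ᵠ-distrib-+ᵠ []       []       []       a b = refl
  -ᵠ-·ᵠ-distrib-+ᵠ (x ∷ xs) (y ∷ ys) (c ∷ cs) a b = cong₂ _∷_ (by-ring x y c a b) (-ᵠ-·ᵠ-distrib-+ᵠ xs ys cs a b)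
    where by-ring : ∀ x y c a b → (x + y) - (a + b) * c ≡ (x - a * c) + (y - b * c)
          by-ring = RingSolver.solve-∀ ℚ-ring

  -ᵠ-·ᵠ-distrib-·ᵠ : ∀ {k} (x c : Vec ℚ k) a b → (a ·ᵠ x) -ᵠ ((a * b) ·ᵠ c) ≡ a ·ᵠ (x -ᵠ (b ·ᵠ c))
  -ᵠ-·ᵠ-distrib-·ᵠ []       []       a b = refl
  -ᵠ-·ᵠ-distrib-·ᵠ (x ∷ xs) (c ∷ cs) a b = cong₂ _∷_ (by-ring x c a b) (-ᵠ-·ᵠ-distrib-·ᵠ xs cs a b)
    where by-ring : ∀ x c a b → a * x - (a * b) * c ≡ a * (x - b * c)
          by-ring = RingSolver.solve-∀ ℚ-ring

  linComb : ∀ {m k} → Vec ℚ m → (Fin m → Vec ℚ k) → Vec ℚ k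
  linComb []       f = 0ᵥ
  linComb (a ∷ as) f = (a ·ᵠ f zero) +ᵠ linComb as (f ∘ suc)

  linComb-cong : ∀ {m k} (as : Vec ℚ m) {f g : Fin m → Vec ℚ k} → f ≗ g → linComb as f ≡ linComb as g
  linComb-cong []       f≗g = refl
  linComb-cong (a ∷ as) f≗g = cong₂ (λ u v → (a ·ᵠ u) +ᵠ v) (f≗g zero) (linComb-cong as (f≗g ∘ suc))

  linComb-0∷ : ∀ {m k} (as : Vec ℚ m) (f : Fin m → Vec ℚ k) → linComb as (λ j → 0ℚ ∷ f j) ≡ 0ℚ ∷ linComb as f
  linComb-0∷ []       f = refl
  linComb-0∷ (a ∷ as) f =
    trans (cong ((a ·ᵠ (0ℚ ∷ f zero)) +ᵠ_) (linComb-0∷ as (f ∘ suc)))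
          (cong (_∷ ((a ·ᵠ f zero) +ᵠ linComb as (f ∘ suc))) (by-ring a))
    where by-ring : ∀ a → a * 0ℚ + 0ℚ ≡ 0ℚ
          by-ring = RingSolver.solve-∀ ℚ-ring

  basis-zero : ∀ {k} → basis {suc k} zero ≡ ℤ.+ 1 ∷ Vec.replicate k (ℤ.+ 0)
  basis-zero {k} = cong (ℤ.+ 1 ∷_) (trans (VecP.tabulate-∘ (λ _ → ℤ.+ 0) (λ i → i)) (VecP.map-const _ (ℤ.+ 0)))

  basis-suc : ∀ {k} (j : Fin k) → basis (suc j) ≡ ℤ.+ 0 ∷ basis j
  basis-suc j = cong (ℤ.+ 0 ∷_) (VecP.tabulate-cong λ i →
    cong (λ b → if b then ℤ.+ 1 else ℤ.+ 0) (Decidable.⌊⌋-map′ _ _ (i Fin.≟ j)))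

  linComb-basis : ∀ {k} (x : Vec ℚ k) → linComb x (ιᵥ ∘ basis) ≡ x
  linComb-basis []                = refl
  linComb-basis {suc k} (a ∷ as) = begin
    (a ·ᵠ ιᵥ (basis zero)) +ᵠ linComb as (ιᵥ ∘ basis ∘ suc)
      ≡⟨ cong₂ _+ᵠ_ (cong (λ v → a ·ᵠ ιᵥ v) basis-zero)
                    (trans (linComb-cong as (cong ιᵥ ∘ basis-suc)) (linComb-0∷ as (ιᵥ ∘ basis))) ⟩
    (a * 1ℚ + 0ℚ) ∷ ((a ·ᵠ ιᵥ (Vec.replicate k (ℤ.+ 0))) +ᵠ linComb as (ιᵥ ∘ basis))
      ≡⟨ cong₂ _∷_ (by-ring a) (cong (λ v → (a ·ᵠ v) +ᵠ linComb as (ιᵥ ∘ basis))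
                             (ιᵥ-0 k)) ⟩
    a ∷ ((a ·ᵠ 0ᵥ) +ᵠ linComb as (ιᵥ ∘ basis))
      ≡⟨ cong (λ v → a ∷ (v +ᵠ linComb as (ιᵥ ∘ basis))) (·ᵠ-zeroʳ a) ⟩
    a ∷ (0ᵥ +ᵠ linComb as (ιᵥ ∘ basis))
      ≡⟨ cong (a ∷_) (trans (+ᵠ-identityˡ _) (linComb-basis as)) ⟩
    a ∷ as ∎
    where open ≡-Reasoning
          by-ring : ∀ a → a * 1ℚ + 0ℚ ≡ a
          by-ring = RingSolver.solve-∀ ℚ-ring

  record IsLinear {k l} (F : Vec ℚ k → Vec ℚ l) : Set where
    field
      +ᵠ-homo : ∀ x y → F (x +ᵠ y) ≡ F x +ᵠ F y
      ·ᵠ-homo : ∀ a x → F (a ·ᵠ x) ≡ a ·ᵠ F x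

    0ᵥ-homo : F 0ᵥ ≡ 0ᵥ
    0ᵥ-homo = begin
      F 0ᵥ            ≡⟨ cong F (sym (·ᵠ-zeroˡ 0ᵥ)) ⟩
      F (0ℚ ·ᵠ 0ᵥ)    ≡⟨ ·ᵠ-homo 0ℚ 0ᵥ ⟩
      0ℚ ·ᵠ F 0ᵥ      ≡⟨ ·ᵠ-zeroˡ (F 0ᵥ) ⟩
      0ᵥ              ∎
      where open ≡-Reasoning

    linComb-homo : ∀ {m} (as : Vec ℚ m) f → F (linComb as f) ≡ linComb as (F ∘ f)
    linComb-homo []       f = 0ᵥ-homo
    linComb-homo (a ∷ as) f = trans (+ᵠ-homo _ _) (cong₂ _+ᵠ_ (·ᵠ-homo a (f zero)) (linComb-homo as (f ∘ suc)))

  linear-ext : ∀ {k l} {F G : Vec ℚ k → Vec ℚ l} → IsLinear F → IsLinear G →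
               (∀ j → F (ιᵥ (basis j)) ≡ G (ιᵥ (basis j))) → F ≗ G
  linear-ext {F = F} {G} F-lin G-lin onBasis x = begin
    F x                             ≡⟨ cong F (sym (linComb-basis x)) ⟩
    F (linComb x (ιᵥ ∘ basis))      ≡⟨ IsLinear.linComb-homo F-lin x _ ⟩
    linComb x (F ∘ ιᵥ ∘ basis)      ≡⟨ linComb-cong x onBasis ⟩
    linComb x (G ∘ ιᵥ ∘ basis)      ≡⟨ sym (IsLinear.linComb-homo G-lin x _) ⟩
    G (linComb x (ιᵥ ∘ basis))      ≡⟨ cong G (linComb-basis x) ⟩
    G x                             ∎
    where open ≡-Reasoning

  q≤0⇒p+q≤p : ∀ p {q} → q ≤ 0ℚ → p + q ≤ p
  q≤0⇒p+q≤p p q≤0 = subst (p + _ ≤_) (ℚP.+-identityʳ p) (ℚP.+-monoʳ-≤ p q≤0)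

  p+q≤p⇒q≤0 : ∀ p {q} → p + q ≤ p → q ≤ 0ℚ
  p+q≤p⇒q≤0 p {q} p+q≤p = subst₂ _≤_ (by-ring p q) (ℚP.+-inverseʳ p) (ℚP.+-monoˡ-≤ (- p) p+q≤p)
    where by-ring : ∀ p q → p + q - p ≡ q
          by-ring = RingSolver.solve-∀ ℚ-ring

  0≤q-p⇒p≤q : ∀ {p q} → 0ℚ ≤ q - p → p ≤ q
  0≤q-p⇒p≤q {p} {q} 0≤q-p = subst₂ _≤_ (ℚP.+-identityˡ p) (by-ring p q) (ℚP.+-monoˡ-≤ p 0≤q-p)
    where by-ring : ∀ p q → (q - p) + p ≡ q
          by-ring = RingSolver.solve-∀ ℚ-ring

  p≤q⇒0≤q-p : ∀ {p q} → p ≤ q → 0ℚ ≤ q - p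
  p≤q⇒0≤q-p {p} {q} p≤q = subst (_≤ q - p) (ℚP.+-inverseʳ p) (ℚP.+-monoˡ-≤ (- p) p≤q)

  p≤q⇒p-q≤0 : ∀ {p q} → p ≤ q → p - q ≤ 0ℚ
  p≤q⇒p-q≤0 {p} {q} p≤q = subst (p - q ≤_) (ℚP.+-inverseʳ q) (ℚP.+-monoˡ-≤ (- q) p≤q)

  ≤∧≢⇒< : ∀ {p q} → p ≤ q → p ≢ q → p < q
  ≤∧≢⇒< {p} {q} p≤q p≢q with ℚP.<-cmp p q
  ... | tri< p<q _ _ = p<q
  ... | tri≈ _ p≡q _ = ⊥-elim (p≢q p≡q)
  ... | tri> _ _ q<p = ⊥-elim (ℚP.<-irrefl refl (ℚP.<-≤-trans q<p p≤q))

  p≡-p⇒p≡0 : ∀ {p} → p ≡ - p → p ≡ 0ℚ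
  p≡-p⇒p≡0 {p} p≡-p = begin
    p               ≡⟨ by-ring p ⟩
    ½ * (p + p)     ≡⟨ cong (λ q → ½ * (p + q)) p≡-p ⟩
    ½ * (p + - p)   ≡⟨ cong (½ *_) (ℚP.+-inverseʳ p) ⟩
    ½ * 0ℚ          ≡⟨ ℚP.*-zeroʳ ½ ⟩
    0ℚ              ∎
    where open ≡-Reasoning
          by-ring : ∀ p → p ≡ ½ * (p + p)
          by-ring = RingSolver.solve-∀ ℚ-ring

  -p≤0⇒0≤p : ∀ {p} → - p ≤ 0ℚ → 0ℚ ≤ p
  -p≤0⇒0≤p {p} -p≤0 = subst₂ _≤_ (ℚP.+-inverseʳ p) (ℚP.+-identityʳ p) (ℚP.+-monoʳ-≤ p -p≤0)

  0≤* : ∀ {p q} → 0ℚ ≤ p → 0ℚ ≤ q → 0ℚ ≤ p * q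
  0≤* {p} {q} 0≤p 0≤q = ℚP.nonNegative⁻¹ _ {{ℚP.nonNeg*nonNeg⇒nonNeg p {{nonNegative 0≤p}} q {{nonNegative 0≤q}}}}

  -- Conditions holding for all sufficiently small e ≥ 0

  Near0⁺ : (ℚ → Set) → Set
  Near0⁺ Q = ∃ λ ε → 0ℚ < ε × (∀ e → 0ℚ ≤ e → e ≤ ε → Q e)

  near0-witness : ∀ {Q} → Near0⁺ Q → ∃ λ e → 0ℚ < e × Q e
  near0-witness (ε , 0<ε , q) = ε , 0<ε , q ε (ℚP.<⇒≤ 0<ε) ℚP.≤-refl

  near0-always : ∀ {Q} → (∀ e → 0ℚ ≤ e → Q e) → Near0⁺ Q
  near0-always q = 1ℚ , ℚP.positive⁻¹ 1ℚ , λ e 0≤e _ → q e 0≤e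

  near0-map : ∀ {P Q} → (∀ e → P e → Q e) → Near0⁺ P → Near0⁺ Q
  near0-map f (ε , 0<ε , p) = ε , 0<ε , λ e 0≤e e≤ε → f e (p e 0≤e e≤ε)

  near0-× : ∀ {P Q} → Near0⁺ P → Near0⁺ Q → Near0⁺ (λ e → P e × Q e)
  near0-× (ε₁ , 0<ε₁ , p) (ε₂ , 0<ε₂ , q) = ε₁ ⊓ ε₂ , 0<ε₁⊓ε₂ , λ e 0≤e e≤ε →
    p e 0≤e (ℚP.≤-trans e≤ε (ℚP.p⊓q≤p ε₁ ε₂)) , q e 0≤e (ℚP.≤-trans e≤ε (ℚP.p⊓q≤q ε₁ ε₂))
    where
    0<ε₁⊓ε₂ : 0ℚ < ε₁ ⊓ ε₂
    0<ε₁⊓ε₂ = [ (λ eq → subst (0ℚ <_) (sym eq) 0<ε₁) , (λ eq → subst (0ℚ <_) (sym eq) 0<ε₂) ]′ (ℚP.⊓-sel ε₁ ε₂)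

  near0-Π : ∀ {K} {Q : Fin K → ℚ → Set} → (∀ k → Near0⁺ (Q k)) → Near0⁺ (λ e → ∀ k → Q k e)
  near0-Π {zero}  _ = near0-always (λ _ _ ())
  near0-Π {suc K} h = near0-map (λ e q → λ { zero → proj₁ q ; (suc k) → proj₂ q k })
                                (near0-× (h zero) (near0-Π (h ∘ suc)))

  near0-0≤ : ∀ {a} b → 0ℚ < a → Near0⁺ (λ e → 0ℚ ≤ a + e * b)
  near0-0≤ {a} b 0<a with 0ℚ ℚP.≤? b
  ... | yes 0≤b = near0-always λ e 0≤e → ℚP.+-mono-≤ (ℚP.<⇒≤ 0<a) (0≤* 0≤e 0≤b)
  ... | no 0≰b = ε , 0<ε , λ e 0≤e e≤ε → subst (0ℚ ≤_) (by-ring a e b) (-c-bound e e≤ε)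
    where
    c = - b
    0<c : 0ℚ < c
    0<c = ℚP.neg-antimono-< (ℚP.≰⇒> 0≰b)
    instance
      c-pos : Positive c
      c-pos = positive 0<c
      c≢0 : NonZero c
      c≢0 = ℚP.pos⇒nonZero c
    ε = a * 1/ c
    0<ε : 0ℚ < ε
    0<ε = ℚP.positive⁻¹ ε {{ℚP.pos*pos⇒pos a {{positive 0<a}} (1/ c) {{ℚP.1/pos⇒pos c}}}}
    εc≡a : ε * c ≡ a
    εc≡a = trans (ℚP.*-assoc a (1/ c) c) (trans (cong (a *_) (ℚP.*-inverseˡ c)) (ℚP.*-identityʳ a))
    -c-bound : ∀ e → e ≤ ε → 0ℚ ≤ a - e * c
    -c-bound e e≤ε = p≤q⇒0≤q-p (subst (e * c ≤_) εc≡a (ℚP.*-monoʳ-≤-nonNeg c {{ℚP.pos⇒nonNeg c}} e≤ε))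
    by-ring : ∀ a e b → a - e * (- b) ≡ a + e * b
    by-ring = RingSolver.solve-∀ ℚ-ring

  near0-≤1 : ∀ {a} b → a < 1ℚ → Near0⁺ (λ e → a + e * b ≤ 1ℚ)
  near0-≤1 {a} b a<1 = near0-map (λ e 0≤ → 0≤q-p⇒p≤q (subst (0ℚ ≤_) (by-ring a e b) 0≤))
                                 (near0-0≤ (- b) (subst (_< 1ℚ - a) (ℚP.+-inverseʳ a) (ℚP.+-monoˡ-< (- a) a<1)))
    where by-ring : ∀ a e b → (1ℚ - a) + e * (- b) ≡ 1ℚ - (a + e * b)
          by-ring = RingSolver.solve-∀ ℚ-ring

  data ±1 : ℤ → Set where
    plus  : ±1 1ℤ
    minus : ±1 -1ℤ

  ιℚ1ℤ*p≡p : ∀ a → ιℚ 1ℤ * a ≡ a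
  ιℚ1ℤ*p≡p = ℚP.*-identityˡ

  ιℚ-1ℤ*p≡-p : ∀ a → ιℚ -1ℤ * a ≡ - a
  ιℚ-1ℤ*p≡-p a = trans (sym (ℚP.neg-distribˡ-* 1ℚ a)) (cong -_ (ℚP.*-identityˡ a))

  ±1-square : ∀ {e} → ±1 e → ιℚ e * ιℚ e ≡ 1ℚ
  ±1-square plus  = refl
  ±1-square minus = refl

  ±1-flip : ∀ {e a b} → ±1 e → a ≡ ιℚ e * b → b ≡ ιℚ e * a
  ±1-flip {e} {a} {b} ±e a≡eb = begin
    b                     ≡⟨ sym (ℚP.*-identityˡ b) ⟩
    1ℚ * b                ≡⟨ cong (_* b) (sym (±1-square ±e)) ⟩
    (ιℚ e * ιℚ e) * b     ≡⟨ ℚP.*-assoc (ιℚ e) (ιℚ e) b ⟩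
    ιℚ e * (ιℚ e * b)     ≡⟨ cong (ιℚ e *_) (sym a≡eb) ⟩
    ιℚ e * a              ∎
    where open ≡-Reasoning

  ±1-cancel : ∀ {e a} → ±1 e → ιℚ e * a ≡ 0ℚ → a ≡ 0ℚ
  ±1-cancel {e} ±e ea≡0 = trans (±1-flip ±e (sym ea≡0)) (ℚP.*-zeroʳ (ιℚ e))

  ±1-unique : ∀ {e e′ r} → ±1 e → ±1 e′ → 0ℚ < ιℚ e * r → 0ℚ < ιℚ e′ * r → e ≡ e′
  ±1-unique plus  plus  _ _ = refl
  ±1-unique minus minus _ _ = refl
  ±1-unique {r = r} plus minus 0<r 0<-r = ⊥-elim (ℚP.<-irrefl (sym (ℚP.+-inverseʳ r))
    (ℚP.+-mono-< (subst (0ℚ <_) (ιℚ1ℤ*p≡p r) 0<r) (subst (0ℚ <_) (ιℚ-1ℤ*p≡-p r) 0<-r)))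
  ±1-unique {r = r} minus plus 0<-r 0<r = sym (±1-unique {r = r} plus minus 0<r 0<-r)

module Alcoves (R : RootDatum) (P : PosSystem R) where

  open import Data.Rational using (ℚ; 0ℚ; 1ℚ; _+_; _*_; _-_; -_; _≤_; _<_; positive)
  import Data.Rational.Properties as ℚP
  open import Data.List using ([]; _∷_; _++_)
  import Tactic.RingSolver as RingSolver
  open Rational
  open Setup R P renaming (trans to translation)

  cv : Fin N → Vec ℚ n
  cv i = ιᵥ (coroot i)

  ⟨i,cvi⟩≡2 : ∀ i → ⟨ i , cv i ⟩ ≡ 1ℚ + 1ℚ
  ⟨i,cvi⟩≡2 i = trans (dot-ιᵥ (root i) (coroot i)) (cong ιℚ (pair-two i))

  ⟨,reflℚ⟩ : ∀ j i x → ⟨ j , reflℚ i x ⟩ ≡ ⟨ j , x ⟩ - ⟨ i , x ⟩ * ⟨ j , cv i ⟩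
  ⟨,reflℚ⟩ j i x = trans (dot-- (root j) x _) (cong (λ u → ⟨ j , x ⟩ - u) (dot-· (root j) ⟨ i , x ⟩ (cv i)))

  ⟨i,reflℚi⟩ : ∀ i x → ⟨ i , reflℚ i x ⟩ ≡ - ⟨ i , x ⟩
  ⟨i,reflℚi⟩ i x = trans (⟨,reflℚ⟩ i i x) (trans (cong (λ u → ⟨ i , x ⟩ - ⟨ i , x ⟩ * u) (⟨i,cvi⟩≡2 i)) (by-ring ⟨ i , x ⟩))
    where by-ring : ∀ p → p - p * (1ℚ + 1ℚ) ≡ - p
          by-ring = RingSolver.solve-∀ ℚ-ring

  reflℚ-involutive : ∀ i x → reflℚ i (reflℚ i x) ≡ x
  reflℚ-involutive i = reflection-involutive (reflℚ i) ⟨ i ,_⟩ (cv i) (λ _ → refl) (⟨i,reflℚi⟩ i)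

  reflℚ-linear : ∀ i → IsLinear (reflℚ i)
  reflℚ-linear i = record
    { +ᵠ-homo = λ x y → trans (cong (λ a → (x +ᵠ y) -ᵠ (a ·ᵠ cv i)) (dot-+ (root i) x y))
                              (-ᵠ-·ᵠ-distrib-+ᵠ x y (cv i) ⟨ i , x ⟩ ⟨ i , y ⟩)
    ; ·ᵠ-homo = λ a x → trans (cong (λ b → (a ·ᵠ x) -ᵠ (b ·ᵠ cv i)) (dot-· (root i) a x))
                              (-ᵠ-·ᵠ-distrib-·ᵠ x (cv i) a ⟨ i , x ⟩)
    }

  reflℚ-ιᵥ : ∀ i y → reflℚ i (ιᵥ y) ≡ ιᵥ (reflℤ i y)
  reflℚ-ιᵥ i y = begin
    ιᵥ y -ᵠ (⟨ i , ιᵥ y ⟩ ·ᵠ cv i)                   ≡⟨ cong (λ a → ιᵥ y -ᵠ (a ·ᵠ cv i)) (dot-ιᵥ (root i) y) ⟩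
    ιᵥ y -ᵠ (ιℚ (dotℤ (root i) y) ·ᵠ cv i)           ≡⟨ cong (ιᵥ y -ᵠ_) (sym (ιᵥ-· (dotℤ (root i) y) (coroot i))) ⟩
    ιᵥ y -ᵠ ιᵥ (dotℤ (root i) y ·ᶻ coroot i)         ≡⟨ sym (ιᵥ-- y _) ⟩
    ιᵥ (reflℤ i y)                                   ∎
    where open ≡-Reasoning

  actℚ-linear : ∀ w → IsLinear (actℚ w)
  actℚ-linear []      = record { +ᵠ-homo = λ _ _ → refl ; ·ᵠ-homo = λ _ _ → refl }
  actℚ-linear (i ∷ w) = record
    { +ᵠ-homo = λ x y → trans (cong (reflℚ i) (+ᵠ-homo x y)) (IsLinear.+ᵠ-homo (reflℚ-linear i) _ _)
    ; ·ᵠ-homo = λ a x → trans (cong (reflℚ i) (·ᵠ-homo a x)) (IsLinear.·ᵠ-homo (reflℚ-linear i) a _)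
    }
    where open IsLinear (actℚ-linear w)

  actℚ-ιᵥ : ∀ w y → actℚ w (ιᵥ y) ≡ ιᵥ (actℤ w y)
  actℚ-ιᵥ []      y = refl
  actℚ-ιᵥ (i ∷ w) y = trans (cong (reflℚ i) (actℚ-ιᵥ w y)) (reflℚ-ιᵥ i _)

  actℚ-++ : ∀ w u x → actℚ (w ++ u) x ≡ actℚ w (actℚ u x)
  actℚ-++ []      u x = refl
  actℚ-++ (i ∷ w) u x = cong (reflℚ i) (actℚ-++ w u x)

  actℚ-surjective : ∀ w z → ∃ λ y → actℚ w y ≡ z
  actℚ-surjective []      z = z , refl
  actℚ-surjective (i ∷ w) z with actℚ-surjective w (reflℚ i z)
  ... | y , wy≡iz = y , trans (cong (reflℚ i) wy≡iz) (reflℚ-involutive i z)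

  apply-∙ : ∀ v u x → apply (v ∙ u) x ≡ apply v (apply u x)
  apply-∙ v u x = begin
    actℚ (word v ++ word u) x +ᵠ ιᵥ (translation v +ᶻ actℤ (word v) (translation u))
      ≡⟨ cong₂ _+ᵠ_ (actℚ-++ (word v) (word u) x) (ιᵥ-+ (translation v) _) ⟩
    actℚ (word v) (actℚ (word u) x) +ᵠ (ιᵥ (translation v) +ᵠ ιᵥ (actℤ (word v) (translation u)))
      ≡⟨ +ᵠ-swapʳ _ _ _ ⟩
    (actℚ (word v) (actℚ (word u) x) +ᵠ ιᵥ (actℤ (word v) (translation u))) +ᵠ ιᵥ (translation v)
      ≡⟨ cong (_+ᵠ ιᵥ (translation v))
              (sym (trans (+ᵠ-homo _ _) (cong (actℚ (word v) (actℚ (word u) x) +ᵠ_) (actℚ-ιᵥ (word v) _)))) ⟩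
    apply v (apply u x) ∎
    where open ≡-Reasoning
          open IsLinear (actℚ-linear (word v))

  linMat-column : ∀ v j → Vec.lookup (linMat v) j ≡ actℤ (word v) (basis j)
  linMat-column v j = VecP.lookup∘tabulate _ j

  ≈⇒apply-≗ : ∀ v u → v ≈ u → ∀ x → apply v x ≡ apply u x
  ≈⇒apply-≗ v u (same-lin , same-trans) x =
    cong₂ _+ᵠ_ (linear-ext (actℚ-linear (word v)) (actℚ-linear (word u)) onBasis x) (cong ιᵥ same-trans)
    where
    onBasis : ∀ j → actℚ (word v) (ιᵥ (basis j)) ≡ actℚ (word u) (ιᵥ (basis j))
    onBasis j = begin
      actℚ (word v) (ιᵥ (basis j))     ≡⟨ actℚ-ιᵥ (word v) (basis j) ⟩
      ιᵥ (actℤ (word v) (basis j))     ≡⟨ cong ιᵥ (sym (linMat-column v j)) ⟩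
      ιᵥ (Vec.lookup (linMat v) j)     ≡⟨ cong (λ M → ιᵥ (Vec.lookup M j)) same-lin ⟩
      ιᵥ (Vec.lookup (linMat u) j)     ≡⟨ cong ιᵥ (linMat-column u j) ⟩
      ιᵥ (actℤ (word u) (basis j))     ≡⟨ sym (actℚ-ιᵥ (word u) (basis j)) ⟩
      actℚ (word u) (ιᵥ (basis j))     ∎
      where open ≡-Reasoning

  apply-0ᵥ : ∀ v → apply v 0ᵥ ≡ ιᵥ (translation v)
  apply-0ᵥ v = trans (cong (_+ᵠ ιᵥ (translation v)) (IsLinear.0ᵥ-homo (actℚ-linear (word v)))) (+ᵠ-identityˡ _)

  apply-≗⇒≈ : ∀ v u → (∀ x → apply v x ≡ apply u x) → v ≈ u
  apply-≗⇒≈ v u v≗u = VecP.tabulate-cong sameColumn , same-trans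
    where
    same-trans : translation v ≡ translation u
    same-trans = ιᵥ-injective (trans (sym (apply-0ᵥ v)) (trans (v≗u 0ᵥ) (apply-0ᵥ u)))
    sameColumn : ∀ j → actℤ (word v) (basis j) ≡ actℤ (word u) (basis j)
    sameColumn j = ιᵥ-injective (begin
      ιᵥ (actℤ (word v) (basis j))    ≡⟨ sym (actℚ-ιᵥ (word v) (basis j)) ⟩
      actℚ (word v) (ιᵥ (basis j))    ≡⟨ +ᵠ-cancelʳ _ _ _ (trans (v≗u (ιᵥ (basis j))) (cong (λ t → _ +ᵠ ιᵥ t) (sym same-trans))) ⟩
      actℚ (word u) (ιᵥ (basis j))    ≡⟨ actℚ-ιᵥ (word u) (basis j) ⟩
      ιᵥ (actℤ (word u) (basis j))    ∎)
      where open ≡-Reasoning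

  ∙-congʳ : ∀ v u w → v ≈ u → (v ∙ w) ≈ (u ∙ w)
  ∙-congʳ v u w v≈u = apply-≗⇒≈ (v ∙ w) (u ∙ w) λ x →
    trans (apply-∙ v w x) (trans (≈⇒apply-≗ v u v≈u (apply w x)) (sym (apply-∙ u w x)))

  Prec-resp-≈ : ∀ s v u → v ≈ u → Prec v s → Prec u s
  Prec-resp-≈ s v u v≈u (j , pj , M , onFace , below) =
    j , pj , M , (λ x x∈Af σx≡x → subst (λ y → ⟨ j , y ⟩ ≡ ιℚ M) (≈⇒apply-≗ v u v≈u x) (onFace x x∈Af σx≡x))
               , (λ x x∈Af → subst (λ y → ⟨ j , y ⟩ ≤ ιℚ M) (≈⇒apply-≗ v u v≈u x) (below x x∈Af))

  ⟨,apply⟩ : ∀ j v x → ⟨ j , apply v x ⟩ ≡ ⟨ j , actℚ (word v) x ⟩ + ιℚ (dotℤ (root j) (translation v))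
  ⟨,apply⟩ j v x = trans (dot-+ (root j) _ _) (cong (⟨ j , actℚ (word v) x ⟩ +_) (dot-ιᵥ (root j) _))

  reflℚ-transpose : ∀ a j → ∃ λ k → ∀ y → ⟨ j , reflℚ a y ⟩ ≡ ⟨ k , y ⟩
  reflℚ-transpose a j with root-refl a j
  ... | k , sₐj≡k = k , λ y → begin
    ⟨ j , reflℚ a y ⟩                                   ≡⟨ ⟨,reflℚ⟩ j a y ⟩
    ⟨ j , y ⟩ - ⟨ a , y ⟩ * ⟨ j , cv a ⟩                ≡⟨ cong (λ u → ⟨ j , y ⟩ - ⟨ a , y ⟩ * u) (dot-ιᵥ (root j) (coroot a)) ⟩
    ⟨ j , y ⟩ - ⟨ a , y ⟩ * ιℚ c                        ≡⟨ cong (λ u → ⟨ j , y ⟩ - u) (ℚP.*-comm ⟨ a , y ⟩ (ιℚ c)) ⟩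
    ⟨ j , y ⟩ - ιℚ c * ⟨ a , y ⟩                        ≡⟨ sym (dot-combˡ (root j) (root a) c y) ⟩
    dotℚ (root j -ᶻ (c ·ᶻ root a)) y                    ≡⟨ cong (λ r → dotℚ r y) sₐj≡k ⟩
    ⟨ k , y ⟩                                           ∎
    where open ≡-Reasoning
          c = dotℤ (root j) (coroot a)

  actℚ-transpose : ∀ w j → ∃ λ k → ∀ y → ⟨ j , actℚ w y ⟩ ≡ ⟨ k , y ⟩
  actℚ-transpose []      j = j , λ _ → refl
  actℚ-transpose (a ∷ w) j with reflℚ-transpose a j
  ... | k , jsₐ≡k with actℚ-transpose w k
  ...   | l , kw≡l = l , λ y → trans (jsₐ≡k (actℚ w y)) (kw≡l y)

  actℚ-transpose⁻¹ : ∀ w j → ∃ λ k → ∀ y → ⟨ k , actℚ w y ⟩ ≡ ⟨ j , y ⟩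
  actℚ-transpose⁻¹ []      j = j , λ _ → refl
  actℚ-transpose⁻¹ (a ∷ w) j with actℚ-transpose⁻¹ w j
  ... | k , kw≡j with reflℚ-transpose a k
  ...   | l , ksₐ≡l = l , λ y → begin
    ⟨ l , reflℚ a (actℚ w y) ⟩                  ≡⟨ sym (ksₐ≡l _) ⟩
    ⟨ k , reflℚ a (reflℚ a (actℚ w y)) ⟩        ≡⟨ cong ⟨ k ,_⟩ (reflℚ-involutive a _) ⟩
    ⟨ k , actℚ w y ⟩                            ≡⟨ kw≡j y ⟩
    ⟨ j , y ⟩                                   ∎
    where open ≡-Reasoning

  neg-root : ∀ j → ∃ λ k → ∀ y → ⟨ k , y ⟩ ≡ - ⟨ j , y ⟩
  neg-root j with reflℚ-transpose j j
  ... | k , jsⱼ≡k = k , λ y → trans (sym (jsⱼ≡k y)) (⟨i,reflℚi⟩ j y)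

  ¬positive⇒neg-positive : ∀ {γ k} → ¬ Positive γ → (∀ y → ⟨ k , y ⟩ ≡ - ⟨ γ , y ⟩) → Positive k
  ¬positive⇒neg-positive {γ} {k} γ≯0 k≡-γ = subst (ℤ.+ 0 ℤ.<_) (sym k≡-γᶻ)
      (ℤP.neg-mono-< (ℤP.≤∧≢⇒< (ℤP.≮⇒≥ γ≯0) (regular γ)))
    where
    k≡-γᶻ : dotℤ (root k) ξ ≡ ℤ.- dotℤ (root γ) ξ
    k≡-γᶻ = ιℚ-injective (begin
      ιℚ (dotℤ (root k) ξ)          ≡⟨ sym (dot-ιᵥ (root k) ξ) ⟩
      ⟨ k , ιᵥ ξ ⟩                  ≡⟨ k≡-γ (ιᵥ ξ) ⟩
      - ⟨ γ , ιᵥ ξ ⟩                ≡⟨ cong -_ (dot-ιᵥ (root γ) ξ) ⟩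
      - ιℚ (dotℤ (root γ) ξ)        ≡⟨ sym (ιℚ-neg (dotℤ (root γ) ξ)) ⟩
      ιℚ (ℤ.- dotℤ (root γ) ξ)      ∎)
      where open ≡-Reasoning

  positive-part : ∀ γ → ∃ λ k → Positive k × ∃ λ e → ±1 e × ∀ y → ⟨ γ , y ⟩ ≡ ιℚ e * ⟨ k , y ⟩
  positive-part γ with ℤ.+ 0 ℤ.<? dotℤ (root γ) ξ
  ... | yes γ>0 = γ , γ>0 , 1ℤ , plus , λ y → sym (ιℚ1ℤ*p≡p ⟨ γ , y ⟩)
  ... | no γ≯0 = k , ¬positive⇒neg-positive γ≯0 k≡-γ , -1ℤ , minus , λ y → begin
    ⟨ γ , y ⟩           ≡⟨ by-ring ⟨ γ , y ⟩ ⟩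
    - (- ⟨ γ , y ⟩)     ≡⟨ cong -_ (sym (k≡-γ y)) ⟩
    - ⟨ k , y ⟩         ≡⟨ sym (ιℚ-1ℤ*p≡-p ⟨ k , y ⟩) ⟩
    ιℚ -1ℤ * ⟨ k , y ⟩  ∎
    where open ≡-Reasoning
          k = proj₁ (neg-root γ)
          k≡-γ = proj₂ (neg-root γ)
          by-ring : ∀ p → p ≡ - (- p)
          by-ring = RingSolver.solve-∀ ℚ-ring

  module AffineReflection (i : Fin N) (m : ℤ) where

    σ : Vec ℚ n → Vec ℚ n
    σ x = reflℚ i x +ᵠ ιᵥ (m ·ᶻ coroot i)

    offset : Vec ℚ n → ℚ
    offset x = ⟨ i , x ⟩ - ιℚ m

    σ-as-reflection : ∀ x → σ x ≡ x -ᵠ (offset x ·ᵠ cv i)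
    σ-as-reflection x = trans (cong (reflℚ i x +ᵠ_) (ιᵥ-· m (coroot i))) (-ᵠ-·ᵠ-+ᵠ-·ᵠ x (cv i) ⟨ i , x ⟩ (ιℚ m))

    offset∘σ : ∀ x → offset (σ x) ≡ - offset x
    offset∘σ x = begin
      ⟨ i , σ x ⟩ - ιℚ m                                       ≡⟨ cong (λ y → ⟨ i , y ⟩ - ιℚ m) (σ-as-reflection x) ⟩
      ⟨ i , x -ᵠ (offset x ·ᵠ cv i) ⟩ - ιℚ m                   ≡⟨ cong (_- ιℚ m) (dot-- (root i) x _) ⟩
      (⟨ i , x ⟩ - ⟨ i , offset x ·ᵠ cv i ⟩) - ιℚ m            ≡⟨ cong (λ u → (⟨ i , x ⟩ - u) - ιℚ m) (dot-· (root i) (offset x) (cv i)) ⟩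
      (⟨ i , x ⟩ - offset x * ⟨ i , cv i ⟩) - ιℚ m             ≡⟨ cong (λ u → (⟨ i , x ⟩ - offset x * u) - ιℚ m) (⟨i,cvi⟩≡2 i) ⟩
      (⟨ i , x ⟩ - (⟨ i , x ⟩ - ιℚ m) * (1ℚ + 1ℚ)) - ιℚ m     ≡⟨ by-ring ⟨ i , x ⟩ (ιℚ m) ⟩
      - offset x                                               ∎
      where open ≡-Reasoning
            by-ring : ∀ p M → (p - (p - M) * (1ℚ + 1ℚ)) - M ≡ - (p - M)
            by-ring = RingSolver.solve-∀ ℚ-ring

    *-offset∘σ : ∀ c x → c * offset (σ x) ≡ - (c * offset x)
    *-offset∘σ c x = trans (cong (c *_) (offset∘σ x)) (sym (ℚP.neg-distribʳ-* c (offset x)))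

    σ-involutive : ∀ x → σ (σ x) ≡ x
    σ-involutive = reflection-involutive σ offset (cv i) σ-as-reflection offset∘σ

    offset≡0⇒σ-fixes : ∀ {x} → offset x ≡ 0ℚ → σ x ≡ x
    offset≡0⇒σ-fixes {x} offset≡0 =
      trans (σ-as-reflection x) (trans (cong (λ a → x -ᵠ (a ·ᵠ cv i)) offset≡0) (-ᵠ-·ᵠ-0 x (cv i)))

    σ-fixes⇒offset≡0 : ∀ {x} → σ x ≡ x → offset x ≡ 0ℚ
    σ-fixes⇒offset≡0 {x} σx≡x = p≡-p⇒p≡0 (trans (cong offset (sym σx≡x)) (offset∘σ x))

  ∙sElem-cancelʳ : ∀ s v u → (v ∙ sElem s) ≈ (u ∙ sElem s) → v ≈ u
  ∙sElem-cancelʳ s@((i , m) , _) v u vs≈us = apply-≗⇒≈ v u λ x → begin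
    apply v x                     ≡⟨ cong (apply v) (sym (σ-involutive x)) ⟩
    apply v (σ (σ x))             ≡⟨ sym (apply-∙ v (sElem s) (σ x)) ⟩
    apply (v ∙ sElem s) (σ x)     ≡⟨ ≈⇒apply-≗ (v ∙ sElem s) (u ∙ sElem s) vs≈us (σ x) ⟩
    apply (u ∙ sElem s) (σ x)     ≡⟨ apply-∙ u (sElem s) (σ x) ⟩
    apply u (σ (σ x))             ≡⟨ cong (apply u) (σ-involutive x) ⟩
    apply u x                     ∎
    where open ≡-Reasoning
          open AffineReflection i m

  module Wall (i : Fin N) (m : ℤ) (wall : IsWall i m) where

    open AffineReflection i m public

    s : Sa
    s = (i , m) , wall

    i>0 : Positive i
    i>0 = proj₁ wall

    x₀ : Vec ℚ n
    x₀ = proj₁ (proj₂ wall)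

    x₀∈Af : InAf x₀
    x₀∈Af = proj₁ (proj₂ (proj₂ wall))

    ⟨i,x₀⟩≡m : ⟨ i , x₀ ⟩ ≡ ιℚ m
    ⟨i,x₀⟩≡m = proj₁ (proj₂ (proj₂ (proj₂ wall)))

    x₀-generic : ∀ j → Positive j → j ≢ i → ∀ k → ⟨ j , x₀ ⟩ ≢ ιℚ k
    x₀-generic = proj₂ (proj₂ (proj₂ (proj₂ wall)))

    offset-x₀ : offset x₀ ≡ 0ℚ
    offset-x₀ = trans (cong (_- ιℚ m) ⟨i,x₀⟩≡m) (ℚP.+-inverseʳ (ιℚ m))

    σx₀≡x₀ : σ x₀ ≡ x₀
    σx₀≡x₀ = offset≡0⇒σ-fixes offset-x₀

    m≡0∨m≡1 : m ≡ ℤ.+ 0 ⊎ m ≡ 1ℤ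
    m≡0∨m≡1 = between (ιℚ-cancel-≤ (subst (0ℚ ≤_) ⟨i,x₀⟩≡m (proj₁ (x₀∈Af i i>0))))
                      (ιℚ-cancel-≤ (subst (_≤ 1ℚ) ⟨i,x₀⟩≡m (proj₂ (x₀∈Af i i>0))))
      where
      between : ∀ {k} → ℤ.+ 0 ℤ.≤ k → k ℤ.≤ 1ℤ → k ≡ ℤ.+ 0 ⊎ k ≡ 1ℤ
      between {ℤ.+ 0}           _ _                         = inj₁ refl
      between {ℤ.+ 1}           _ _                         = inj₂ refl
      between {ℤ.+ suc (suc _)} _ (ℤ.+≤+ (ℕ.s≤s ()))
      between { -[1+ _ ]}       () _

    Af-side : (∀ x → InAf x → 0ℚ ≤ offset x) ⊎ (∀ x → InAf x → offset x ≤ 0ℚ)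
    Af-side with m≡0∨m≡1
    ... | inj₁ refl = inj₁ λ x x∈Af → p≤q⇒0≤q-p (proj₁ (x∈Af i i>0))
    ... | inj₂ refl = inj₂ λ x x∈Af → p≤q⇒p-q≤0 (proj₂ (x∈Af i i>0))

    pushed : ℚ → Vec ℚ n
    pushed e = x₀ +ᵠ (e ·ᵠ cv i)

    ⟨,pushed⟩ : ∀ k e → ⟨ k , pushed e ⟩ ≡ ⟨ k , x₀ ⟩ + e * ⟨ k , cv i ⟩
    ⟨,pushed⟩ k e = trans (dot-+ (root k) x₀ _) (cong (⟨ k , x₀ ⟩ +_) (dot-· (root k) e (cv i)))

    offset-pushed : ∀ e → offset (pushed e) ≡ e * (1ℚ + 1ℚ)
    offset-pushed e = begin
      ⟨ i , pushed e ⟩ - ιℚ m                     ≡⟨ cong (_- ιℚ m) (⟨,pushed⟩ i e) ⟩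
      (⟨ i , x₀ ⟩ + e * ⟨ i , cv i ⟩) - ιℚ m      ≡⟨ cong₂ (λ a b → (a + e * b) - ιℚ m) ⟨i,x₀⟩≡m (⟨i,cvi⟩≡2 i) ⟩
      (ιℚ m + e * (1ℚ + 1ℚ)) - ιℚ m               ≡⟨ by-ring (ιℚ m) e ⟩
      e * (1ℚ + 1ℚ)                               ∎
      where open ≡-Reasoning
            by-ring : ∀ M e → (M + e * (1ℚ + 1ℚ)) - M ≡ e * (1ℚ + 1ℚ)
            by-ring = RingSolver.solve-∀ ℚ-ring

    near0-pushed∈Af : ⟨ i , x₀ ⟩ < 1ℚ → Near0⁺ (λ e → InAf (pushed e))
    near0-pushed∈Af ⟨i,x₀⟩<1 =
      near0-map (λ e inUnit k k>0 → subst InUnit (sym (⟨,pushed⟩ k e)) (inUnit k k>0)) (near0-Π bounds)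
      where
      0≤⟨i,cvi⟩ : 0ℚ ≤ ⟨ i , cv i ⟩
      0≤⟨i,cvi⟩ = subst (0ℚ ≤_) (sym (⟨i,cvi⟩≡2 i)) (ℚP.<⇒≤ (ℚP.positive⁻¹ (1ℚ + 1ℚ)))
      bounds : ∀ k → Near0⁺ (λ e → Positive k → InUnit (⟨ k , x₀ ⟩ + e * ⟨ k , cv i ⟩))
      bounds k with k Fin.≟ i
      ... | yes refl = near0-map (λ _ inUnit _ → inUnit) (near0-× (near0-always λ e 0≤e →
              ℚP.+-mono-≤ (proj₁ (x₀∈Af i i>0)) (0≤* 0≤e 0≤⟨i,cvi⟩))
              (near0-≤1 _ ⟨i,x₀⟩<1))
      ... | no k≢i with ℤ.+ 0 ℤ.<? dotℤ (root k) ξ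
      ...   | no k≯0  = near0-always λ _ _ k>0 → ⊥-elim (k≯0 k>0)
      ...   | yes k>0 = near0-map (λ _ inUnit _ → inUnit) (near0-× (near0-0≤ _ 0<⟨k,x₀⟩) (near0-≤1 _ ⟨k,x₀⟩<1))
        where
        0<⟨k,x₀⟩ : 0ℚ < ⟨ k , x₀ ⟩
        0<⟨k,x₀⟩ = ≤∧≢⇒< (proj₁ (x₀∈Af k k>0)) (λ 0≡ → x₀-generic k k>0 k≢i (ℤ.+ 0) (sym 0≡))
        ⟨k,x₀⟩<1 : ⟨ k , x₀ ⟩ < 1ℚ
        ⟨k,x₀⟩<1 = ≤∧≢⇒< (proj₂ (x₀∈Af k k>0)) (x₀-generic k k>0 k≢i 1ℤ)

    -- For m = 1 the origin will do; for m = 0 push x₀ a little along α_i^∨, which keeps it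
    -- inside A_f because x₀ is on no other wall.
    off-wall : ∃ λ x → InAf x × offset x ≢ 0ℚ
    off-wall with m≡0∨m≡1
    ... | inj₁ refl with near0-witness (near0-pushed∈Af (subst (_< 1ℚ) (sym ⟨i,x₀⟩≡m) (ℚP.positive⁻¹ 1ℚ)))
    ...   | ε , 0<ε , pushed∈Af = pushed ε , pushed∈Af , λ offset≡0 → ℚP.<⇒≢ 0<offset (sym offset≡0)
      where
      0<offset : 0ℚ < offset (pushed ε)
      0<offset = subst (0ℚ <_) (sym (offset-pushed ε)) (ℚP.positive⁻¹ _ {{ℚP.pos*pos⇒pos ε {{positive 0<ε}} (1ℚ + 1ℚ)}})
    off-wall | inj₂ refl = 0ᵥ , 0ᵥ∈Af , λ offset≡0 → case trans (cong (_- 1ℚ) (sym (dot-0ᵥ (root i)))) offset≡0 of λ ()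
      where
      0ᵥ∈Af : InAf 0ᵥ
      0ᵥ∈Af k _ = subst InUnit (sym (dot-0ᵥ (root k))) (ℚP.≤-refl , ℚP.<⇒≤ (ℚP.positive⁻¹ 1ℚ))

    -- B then maps the wall H_{α_i,m} into a hyperplane ⟨α_j, x⟩ = const.
    record Aligned (B : Aff) (j : Fin N) (e : ℤ) : Set where
      constructor aligned
      field pullback : ∀ y → ⟨ j , actℚ (word B) y ⟩ ≡ ιℚ e * ⟨ i , y ⟩
    open Aligned

    level : Aff → Fin N → ℤ → ℤ
    level B j e = e ℤ.* m ℤ.+ dotℤ (root j) (translation B)

    aligned-apply : ∀ {B j e} → Aligned B j e → ∀ x → ⟨ j , apply B x ⟩ ≡ ιℚ (level B j e) + ιℚ e * offset x
    aligned-apply {B} {j} {e} al x = begin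
      ⟨ j , apply B x ⟩                               ≡⟨ ⟨,apply⟩ j B x ⟩
      ⟨ j , actℚ (word B) x ⟩ + ιℚ T                  ≡⟨ cong (_+ ιℚ T) (pullback al x) ⟩
      ιℚ e * ⟨ i , x ⟩ + ιℚ T                         ≡⟨ by-ring (ιℚ e) ⟨ i , x ⟩ (ιℚ m) (ιℚ T) ⟩
      (ιℚ e * ιℚ m + ιℚ T) + ιℚ e * offset x          ≡⟨ cong (λ a → (a + ιℚ T) + ιℚ e * offset x) (sym (ιℚ-* e m)) ⟩
      (ιℚ (e ℤ.* m) + ιℚ T) + ιℚ e * offset x         ≡⟨ cong (_+ ιℚ e * offset x) (sym (ιℚ-+ (e ℤ.* m) T)) ⟩
      ιℚ (level B j e) + ιℚ e * offset x              ∎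
      where open ≡-Reasoning
            T = dotℤ (root j) (translation B)
            by-ring : ∀ e p M T → e * p + T ≡ (e * M + T) + e * (p - M)
            by-ring = RingSolver.solve-∀ ℚ-ring

    aligned-at-x₀ : ∀ {B j e} → Aligned B j e → ⟨ j , apply B x₀ ⟩ ≡ ιℚ (level B j e)
    aligned-at-x₀ {B} {j} {e} al = begin
      ⟨ j , apply B x₀ ⟩                        ≡⟨ aligned-apply al x₀ ⟩
      ιℚ (level B j e) + ιℚ e * offset x₀       ≡⟨ cong (λ o → ιℚ (level B j e) + ιℚ e * o) offset-x₀ ⟩
      ιℚ (level B j e) + ιℚ e * 0ℚ              ≡⟨ cong (ιℚ (level B j e) +_) (ℚP.*-zeroʳ (ιℚ e)) ⟩
      ιℚ (level B j e) + 0ℚ                     ≡⟨ ℚP.+-identityʳ _ ⟩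
      ιℚ (level B j e)                          ∎
      where open ≡-Reasoning

    aligned-below : ∀ {B j e x} → Aligned B j e → ⟨ j , apply B x ⟩ ≤ ⟨ j , apply B x₀ ⟩ →
                    ιℚ e * offset x ≤ 0ℚ
    aligned-below {x = x} al below = p+q≤p⇒q≤0 _ (subst₂ _≤_ (aligned-apply al x) (aligned-at-x₀ al) below)

    aligned-positive : ∀ {B j e y} → actℚ (word B) y ≡ ιᵥ ξ → Positive j → Aligned B j e →
                       0ℚ < ιℚ e * ⟨ i , y ⟩
    aligned-positive {B} {j} {e} {y} wy≡ξ j>0 al = subst (0ℚ <_) ⟨j,ξ⟩≡e⟨i,y⟩ (ιℚ-mono-< j>0)
      where
      ⟨j,ξ⟩≡e⟨i,y⟩ : ιℚ (dotℤ (root j) ξ) ≡ ιℚ e * ⟨ i , y ⟩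
      ⟨j,ξ⟩≡e⟨i,y⟩ = trans (sym (dot-ιᵥ (root j) ξ)) (trans (cong ⟨ j ,_⟩ (sym wy≡ξ)) (pullback al y))

    aligned-exists : ∀ B → ∃ λ k → Positive k × ∃ λ e → ±1 e × Aligned B k e
    aligned-exists B =
      let k₀ , k₀w≡i = actℚ-transpose⁻¹ (word B) i
          k , k>0 , e , ±e , k₀≡ek = positive-part k₀
      in k , k>0 , e , ±e , aligned λ y → trans (±1-flip ±e (k₀≡ek (actℚ (word B) y))) (cong (ιℚ e *_) (k₀w≡i y))

    -- x₀ lies on no hyperplane H_{β,k} with β ≠ α_i, so a root that is integral at B x₀ pulls back to ±α_i.
    aligned-wall : ∀ B j M → ⟨ j , apply B x₀ ⟩ ≡ ιℚ M → ∃ λ e → ±1 e × Aligned B j e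
    aligned-wall B j M onWall = conclude (proj₂ (actℚ-transpose (word B) j)) (positive-part _)
      where
      T = dotℤ (root j) (translation B)
      ⟨j,wx₀⟩≡M-T : ⟨ j , actℚ (word B) x₀ ⟩ ≡ ιℚ (M ℤ.- T)
      ⟨j,wx₀⟩≡M-T = begin
        ⟨ j , actℚ (word B) x₀ ⟩                         ≡⟨ by-ring _ (ιℚ T) ⟩
        (⟨ j , actℚ (word B) x₀ ⟩ + ιℚ T) - ιℚ T         ≡⟨ cong (_- ιℚ T) (trans (sym (⟨,apply⟩ j B x₀)) onWall) ⟩
        ιℚ M - ιℚ T                                      ≡⟨ sym (ιℚ-- M T) ⟩
        ιℚ (M ℤ.- T)                                     ∎
        where open ≡-Reasoning
              by-ring : ∀ a T → a ≡ (a + T) - T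
              by-ring = RingSolver.solve-∀ ℚ-ring
      conclude : ∀ {γ} → (∀ y → ⟨ j , actℚ (word B) y ⟩ ≡ ⟨ γ , y ⟩) →
                 (∃ λ k → Positive k × ∃ λ e → ±1 e × ∀ y → ⟨ γ , y ⟩ ≡ ιℚ e * ⟨ k , y ⟩) →
                 ∃ λ e → ±1 e × Aligned B j e
      conclude {γ} jw≡γ (k , k>0 , e , ±e , γ≡ek) with k Fin.≟ i
      ... | yes refl = e , ±e , aligned λ y → trans (jw≡γ y) (γ≡ek y)
      ... | no k≢i = ⊥-elim (x₀-generic k k>0 k≢i (e ℤ.* (M ℤ.- T)) (begin
        ⟨ k , x₀ ⟩                   ≡⟨ ±1-flip ±e (γ≡ek x₀) ⟩
        ιℚ e * ⟨ γ , x₀ ⟩            ≡⟨ cong (ιℚ e *_) (trans (sym (jw≡γ x₀)) ⟨j,wx₀⟩≡M-T) ⟩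
        ιℚ e * ιℚ (M ℤ.- T)          ≡⟨ sym (ιℚ-* e (M ℤ.- T)) ⟩
        ιℚ (e ℤ.* (M ℤ.- T))         ∎))
        where open ≡-Reasoning

    prec-intro : ∀ C {k} M (g : Vec ℚ n → ℚ) → Positive k → (∀ x → ⟨ k , apply C x ⟩ ≡ ιℚ M + g x) →
                 (∀ x → offset x ≡ 0ℚ → g x ≡ 0ℚ) → (∀ x → InAf x → g x ≤ 0ℚ) → Prec C s
    prec-intro C {k} M g k>0 ⟨k,C⟩≡M+g g-onWall g≤0 = k , k>0 , M , onFace , below
      where
      onFace : ∀ x → InAf x → σ x ≡ x → ⟨ k , apply C x ⟩ ≡ ιℚ M
      onFace x _ σx≡x =
        trans (⟨k,C⟩≡M+g x) (trans (cong (ιℚ M +_) (g-onWall x (σ-fixes⇒offset≡0 σx≡x))) (ℚP.+-identityʳ _))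
      below : ∀ x → InAf x → ⟨ k , apply C x ⟩ ≤ ιℚ M
      below x x∈Af = subst (_≤ ιℚ M) (sym (⟨k,C⟩≡M+g x)) (q≤0⇒p+q≤p _ (g≤0 x x∈Af))

    ±offset-sign : ∀ {e} → ±1 e →
                   (∀ x → InAf x → ιℚ e * offset x ≤ 0ℚ) ⊎ (∀ x → InAf x → 0ℚ ≤ ιℚ e * offset x)
    ±offset-sign plus with Af-side
    ... | inj₁ 0≤o = inj₂ λ x x∈Af → subst (0ℚ ≤_) (sym (ιℚ1ℤ*p≡p _)) (0≤o x x∈Af)
    ... | inj₂ o≤0 = inj₁ λ x x∈Af → subst (_≤ 0ℚ) (sym (ιℚ1ℤ*p≡p _)) (o≤0 x x∈Af)
    ±offset-sign minus with Af-side
    ... | inj₁ 0≤o = inj₁ λ x x∈Af → subst (_≤ 0ℚ) (sym (ιℚ-1ℤ*p≡-p _)) (ℚP.neg-antimono-≤ (0≤o x x∈Af))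
    ... | inj₂ o≤0 = inj₂ λ x x∈Af → subst (0ℚ ≤_) (sym (ιℚ-1ℤ*p≡-p _)) (ℚP.neg-antimono-≤ (o≤0 x x∈Af))

    ⟨,apply∙s⟩ : ∀ j B x → ⟨ j , apply (B ∙ sElem s) x ⟩ ≡ ⟨ j , apply B (σ x) ⟩
    ⟨,apply∙s⟩ j B x = cong ⟨ j ,_⟩ (apply-∙ B (sElem s) x)

    apply∙s-x₀ : ∀ B → apply (B ∙ sElem s) x₀ ≡ apply B x₀
    apply∙s-x₀ B = trans (apply-∙ B (sElem s) x₀) (cong (apply B) σx₀≡x₀)

    prec⊎prec∙s : ∀ B → Prec B s ⊎ Prec (B ∙ sElem s) s
    prec⊎prec∙s B =
      let k , k>0 , e , ±e , al = aligned-exists B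
          onB : (∀ x → InAf x → ιℚ e * offset x ≤ 0ℚ) → Prec B s
          onB = prec-intro B (level B k e) (λ x → ιℚ e * offset x) k>0 (aligned-apply al)
                           (λ x o≡0 → trans (cong (ιℚ e *_) o≡0) (ℚP.*-zeroʳ (ιℚ e)))
          onB∙s : (∀ x → InAf x → 0ℚ ≤ ιℚ e * offset x) → Prec (B ∙ sElem s) s
          onB∙s 0≤eo = prec-intro (B ∙ sElem s) (level B k e) (λ x → ιℚ e * offset (σ x)) k>0
                         (λ x → trans (⟨,apply∙s⟩ k B x) (aligned-apply al (σ x)))
                         (λ x o≡0 → trans (cong (λ y → ιℚ e * offset y) (offset≡0⇒σ-fixes o≡0))
                                          (trans (cong (ιℚ e *_) o≡0) (ℚP.*-zeroʳ (ιℚ e))))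
                         (λ x x∈Af → subst (_≤ 0ℚ) (sym (*-offset∘σ (ιℚ e) x)) (ℚP.neg-antimono-≤ (0≤eo x x∈Af)))
      in Sum.map onB onB∙s (±offset-sign ±e)

    ¬prec⇒prec∙s : ∀ B → ¬ Prec B s → Prec (B ∙ sElem s) s
    ¬prec⇒prec∙s B ¬prec = Sum.[ (λ prec → ⊥-elim (¬prec prec)) , (λ prec∙s → prec∙s) ]′ (prec⊎prec∙s B)

    Af⊄wall : ∀ {e} → ±1 e → (∀ x → InAf x → ιℚ e * offset x ≤ 0ℚ) →
              (∀ x → InAf x → ιℚ e * offset (σ x) ≤ 0ℚ) → ⊥
    Af⊄wall {e} ±e eo≤0 eoσ≤0 =
      let x₁ , x₁∈Af , o≢0 = off-wall
          0≤eo : 0ℚ ≤ ιℚ e * offset x₁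
          0≤eo = -p≤0⇒0≤p (subst (_≤ 0ℚ) (*-offset∘σ (ιℚ e) x₁) (eoσ≤0 x₁ x₁∈Af))
      in o≢0 (±1-cancel ±e (ℚP.≤-antisym (eo≤0 x₁ x₁∈Af) 0≤eo))

    prec⇒¬prec∙s : ∀ B → Prec B s → ¬ Prec (B ∙ sElem s) s
    prec⇒¬prec∙s B (j , j>0 , M , onFace , below) (j′ , j′>0 , M′ , onFace′ , below′) =
      let onWall : ⟨ j , apply B x₀ ⟩ ≡ ιℚ M
          onWall = onFace x₀ x₀∈Af σx₀≡x₀
          onWall′ : ⟨ j′ , apply B x₀ ⟩ ≡ ιℚ M′
          onWall′ = trans (cong ⟨ j′ ,_⟩ (sym (apply∙s-x₀ B))) (onFace′ x₀ x₀∈Af σx₀≡x₀)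
          e , ±e , al = aligned-wall B j M onWall
          e′ , ±e′ , al′ = aligned-wall B j′ M′ onWall′
          y , wy≡ξ = actℚ-surjective (word B) (ιᵥ ξ)
          e≡e′ = ±1-unique ±e ±e′ (aligned-positive wy≡ξ j>0 al) (aligned-positive wy≡ξ j′>0 al′)
      in Af⊄wall ±e (λ x x∈Af → aligned-below al (subst (_ ≤_) (sym onWall) (below x x∈Af)))
                    (λ x x∈Af → subst (λ e″ → ιℚ e″ * offset (σ x) ≤ 0ℚ) (sym e≡e′)
                       (aligned-below al′ (subst₂ _≤_ (⟨,apply∙s⟩ j′ B x) (sym onWall′) (below′ x x∈Af))))

module Galleries (R : RootDatum) (P : PosSystem R) (prm : Setup.Params R P)
                 (dec : ∀ v s → Dec (Setup.Prec R P v s)) (q : ℤ) where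

  open import Data.Integer using (_+_; _*_; _-_; +_)
  open import Data.List as List using ([]; _∷_; _++_)
  import Data.List.Properties as ListP
  open Setup R P hiding (trans)
  open Weights prm dec q
  open Alcoves R P using (Prec-resp-≈; ∙-congʳ; ∙sElem-cancelʳ)

  crossWeight foldWeight : Aff → Sa → ℤ
  crossWeight A s = if ⌊ dec A s ⌋ then qs s else + 1
  foldWeight  A s = if ⌊ dec A s ⌋ then + 0 else (qs s - + 1)

  -- Lʷ A t f = Σ_B L_t(A,B) f(B), unfolded one letter of t at a time.
  Lʷ : Aff → Type → (Aff → ℤ) → ℤ
  Lʷ A []           f = f A
  Lʷ A (inj₂ o ∷ t) f = Lʷ (A ∙ proj₁ o) t f
  Lʷ A (inj₁ s ∷ t) f = crossWeight A s * Lʷ (A ∙ sElem s) t f + foldWeight A s * Lʷ A t f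

  δ : Aff → Aff → ℤ
  δ B E = if ⌊ E ≈? B ⌋ then + 1 else + 0

  sumℤ-++ : ∀ xs ys → sumℤ (xs ++ ys) ≡ sumℤ xs + sumℤ ys
  sumℤ-++ []       ys = sym (ℤP.+-identityˡ _)
  sumℤ-++ (x ∷ xs) ys = trans (cong (λ y → x + y) (sumℤ-++ xs ys)) (sym (ℤP.+-assoc x _ _))

  sumℤ-scale : ∀ {X : Set} a (F : X → ℤ) xs → sumℤ (List.map (λ c → a * F c) xs) ≡ a * sumℤ (List.map F xs)
  sumℤ-scale a F []       = sym (ℤP.*-zeroʳ a)
  sumℤ-scale a F (x ∷ xs) = trans (cong (λ y → a * F x + y) (sumℤ-scale a F xs)) (sym (ℤP.*-distribˡ-+ a (F x) _))

  L≡Lʷ : ∀ t A B → L t A B ≡ Lʷ A t (δ B)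
  L≡Lʷ []           A B = ℤP.+-identityʳ _
  L≡Lʷ (inj₂ o ∷ t) A B = trans (cong sumℤ (sym (ListP.map-∘ (allChoices t)))) (L≡Lʷ t (A ∙ proj₁ o) B)
  L≡Lʷ (inj₁ s ∷ t) A B = begin
    sumℤ (List.map F (List.map (cross s∷_) cs ++ List.map (fold s∷_) cs))
      ≡⟨ cong sumℤ (ListP.map-++ F (List.map (cross s∷_) cs) _) ⟩
    sumℤ (List.map F (List.map (cross s∷_) cs) ++ List.map F (List.map (fold s∷_) cs))
      ≡⟨ sumℤ-++ (List.map F (List.map (cross s∷_) cs)) (List.map F (List.map (fold s∷_) cs)) ⟩
    sumℤ (List.map F (List.map (cross s∷_) cs)) + sumℤ (List.map F (List.map (fold s∷_) cs))
      ≡⟨ sym (cong₂ _+_ (cong sumℤ (ListP.map-∘ cs)) (cong sumℤ (ListP.map-∘ cs))) ⟩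
    sumℤ (List.map (λ c → crossWeight A s * contrib (A ∙ sElem s) t c B) cs)
      + sumℤ (List.map (λ c → foldWeight A s * contrib A t c B) cs)
      ≡⟨ cong₂ _+_ (sumℤ-scale (crossWeight A s) (λ c → contrib (A ∙ sElem s) t c B) cs)
                   (sumℤ-scale (foldWeight A s) (λ c → contrib A t c B) cs) ⟩
    crossWeight A s * L t (A ∙ sElem s) B + foldWeight A s * L t A B
      ≡⟨ cong₂ (λ a b → crossWeight A s * a + foldWeight A s * b) (L≡Lʷ t (A ∙ sElem s) B) (L≡Lʷ t A B) ⟩
    Lʷ A (inj₁ s ∷ t) (δ B) ∎
    where open ≡-Reasoning
          cs = allChoices t
          F = λ c → contrib A (inj₁ s ∷ t) c B

  Lʷ-++ : ∀ t u A f → Lʷ A (t ++ u) f ≡ Lʷ A t (λ E → Lʷ E u f)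
  Lʷ-++ []           u A f = refl
  Lʷ-++ (inj₂ o ∷ t) u A f = Lʷ-++ t u (A ∙ proj₁ o) f
  Lʷ-++ (inj₁ s ∷ t) u A f =
    cong₂ (λ a b → crossWeight A s * a + foldWeight A s * b) (Lʷ-++ t u (A ∙ sElem s) f) (Lʷ-++ t u A f)

  Lʷ-cong : ∀ t A {f g} → (∀ E → f E ≡ g E) → Lʷ A t f ≡ Lʷ A t g
  Lʷ-cong []           A f≗g = f≗g A
  Lʷ-cong (inj₂ o ∷ t) A f≗g = Lʷ-cong t (A ∙ proj₁ o) f≗g
  Lʷ-cong (inj₁ s ∷ t) A f≗g =
    cong₂ (λ a b → crossWeight A s * a + foldWeight A s * b) (Lʷ-cong t (A ∙ sElem s) f≗g) (Lʷ-cong t A f≗g)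

  Lʷ-linear : ∀ t A a b f g → Lʷ A t (λ E → a * f E + b * g E) ≡ a * Lʷ A t f + b * Lʷ A t g
  Lʷ-linear []           A a b f g = refl
  Lʷ-linear (inj₂ o ∷ t) A a b f g = Lʷ-linear t (A ∙ proj₁ o) a b f g
  Lʷ-linear (inj₁ s ∷ t) A a b f g = begin
    c * Lʷ (A ∙ sElem s) t h + d * Lʷ A t h
      ≡⟨ cong₂ (λ x y → c * x + d * y) (Lʷ-linear t (A ∙ sElem s) a b f g) (Lʷ-linear t A a b f g) ⟩
    c * (a * Lʷ (A ∙ sElem s) t f + b * Lʷ (A ∙ sElem s) t g) + d * (a * Lʷ A t f + b * Lʷ A t g)
      ≡⟨ by-ring c d a b _ _ _ _ ⟩
    a * (c * Lʷ (A ∙ sElem s) t f + d * Lʷ A t f) + b * (c * Lʷ (A ∙ sElem s) t g + d * Lʷ A t g) ∎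
    where open ≡-Reasoning
          c = crossWeight A s
          d = foldWeight A s
          h = λ E → a * f E + b * g E
          by-ring : ∀ c d a b x y z w → c * (a * x + b * y) + d * (a * z + b * w)
                                        ≡ a * (c * x + d * z) + b * (c * y + d * w)
          by-ring = ℤ-Solver.solve-∀

  ⌊⌋-⇔ : ∀ {X Y : Set} → X ⇔ Y → (x? : Dec X) (y? : Dec Y) → ⌊ x? ⌋ ≡ ⌊ y? ⌋
  ⌊⌋-⇔ X⇔Y x? y? = trans (Decidable.isYes≗does x?) (trans (Decidable.does-⇔ X⇔Y x? y?) (sym (Decidable.isYes≗does y?)))

  ≈-sym : ∀ u v → u ≈ v → v ≈ u
  ≈-sym _ _ (same-lin , same-trans) = sym same-lin , sym same-trans

  δ-resp : ∀ E B E′ B′ → (E ≈ B → E′ ≈ B′) → (E′ ≈ B′ → E ≈ B) → δ B E ≡ δ B′ E′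
  δ-resp E B E′ B′ to from = cong (λ b → if b then + 1 else + 0) (⌊⌋-⇔ (mk⇔ to from) (E ≈? B) (E′ ≈? B′))

  ≺?-resp : ∀ s E B → E ≈ B → ⌊ dec E s ⌋ ≡ ⌊ dec B s ⌋
  ≺?-resp s E B E≈B = ⌊⌋-⇔ (mk⇔ (Prec-resp-≈ s E B E≈B) (Prec-resp-≈ s B E (≈-sym E B E≈B))) (dec E s) (dec B s)

  δ-absorb : ∀ (g : Aff → ℤ) B → (∀ E → E ≈ B → g E ≡ g B) → ∀ E → g E * δ B E ≡ g B * δ B E
  δ-absorb g B g-resp E with E ≈? B
  ... | yes E≈B = cong (_* + 1) (g-resp E E≈B)
  ... | no  _   = trans (ℤP.*-zeroʳ (g E)) (sym (ℤP.*-zeroʳ (g B)))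

  L-snoc : ∀ t s A B → L (t ++ inj₁ s ∷ []) A (B ∙ sElem s)
                       ≡ crossWeight B s * L t A B + foldWeight (B ∙ sElem s) s * L t A (B ∙ sElem s)
  L-snoc t s A B = begin
    L (t ++ inj₁ s ∷ []) A (B ∙ s′)
      ≡⟨ L≡Lʷ (t ++ inj₁ s ∷ []) A (B ∙ s′) ⟩
    Lʷ A (t ++ inj₁ s ∷ []) (δ (B ∙ s′))
      ≡⟨ Lʷ-++ t (inj₁ s ∷ []) A (δ (B ∙ s′)) ⟩
    Lʷ A t (λ E → crossWeight E s * δ (B ∙ s′) (E ∙ s′) + foldWeight E s * δ (B ∙ s′) E)
      ≡⟨ Lʷ-cong t A lastStep ⟩
    Lʷ A t (λ E → crossWeight B s * δ B E + foldWeight (B ∙ s′) s * δ (B ∙ s′) E)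
      ≡⟨ Lʷ-linear t A (crossWeight B s) (foldWeight (B ∙ s′) s) (δ B) (δ (B ∙ s′)) ⟩
    crossWeight B s * Lʷ A t (δ B) + foldWeight (B ∙ s′) s * Lʷ A t (δ (B ∙ s′))
      ≡⟨ sym (cong₂ (λ a b → crossWeight B s * a + foldWeight (B ∙ s′) s * b) (L≡Lʷ t A B) (L≡Lʷ t A (B ∙ s′))) ⟩
    crossWeight B s * L t A B + foldWeight (B ∙ s′) s * L t A (B ∙ s′) ∎
    where
    open ≡-Reasoning
    s′ = sElem s
    lastStep : ∀ E → crossWeight E s * δ (B ∙ s′) (E ∙ s′) + foldWeight E s * δ (B ∙ s′) E
                     ≡ crossWeight B s * δ B E + foldWeight (B ∙ s′) s * δ (B ∙ s′) E
    lastStep E = cong₂ _+_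
      (trans (cong (crossWeight E s *_) (δ-resp (E ∙ s′) (B ∙ s′) E B (∙sElem-cancelʳ s E B) (∙-congʳ E B s′)))
             (δ-absorb (λ C → crossWeight C s) B
                       (λ C C≈B → cong (λ b → if b then qs s else + 1) (≺?-resp s C B C≈B)) E))
      (δ-absorb (λ C → foldWeight C s) (B ∙ s′)
                (λ C C≈Bs → cong (λ b → if b then + 0 else (qs s - + 1)) (≺?-resp s C (B ∙ s′) C≈Bs)) E)

  crossWeight-≺ : ∀ {B s} → Prec B s → crossWeight B s ≡ qs s
  crossWeight-≺ {B} {s} B≺Bs with dec B s
  ... | yes _   = refl
  ... | no B⊀Bs = ⊥-elim (B⊀Bs B≺Bs)

  crossWeight-⊀ : ∀ {B s} → ¬ Prec B s → crossWeight B s ≡ + 1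
  crossWeight-⊀ {B} {s} B⊀Bs with dec B s
  ... | yes B≺Bs = ⊥-elim (B⊀Bs B≺Bs)
  ... | no _     = refl

  foldWeight-≺ : ∀ {B s} → Prec B s → foldWeight B s ≡ + 0
  foldWeight-≺ {B} {s} B≺Bs with dec B s
  ... | yes _   = refl
  ... | no B⊀Bs = ⊥-elim (B⊀Bs B≺Bs)

  foldWeight-⊀ : ∀ {B s} → ¬ Prec B s → foldWeight B s ≡ qs s - + 1
  foldWeight-⊀ {B} {s} B⊀Bs with dec B s
  ... | yes B≺Bs = ⊥-elim (B⊀Bs B≺Bs)
  ... | no _     = refl

open import Data.Integer using (_+_; _*_; _-_; +_)
open import Data.List using (_∷_; []; _++_)

lemma5p4 : (R : RootDatum) (P : PosSystem R) (prm : Setup.Params R P)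
    (dec : ∀ v s → Dec (Setup.Prec R P v s)) (q : ℤ)
    (t : Setup.Type R P) (s : Setup.Sa R P) (A B : Setup.Aff R P) →
    (¬ Setup.Prec R P B s →
      Setup.Weights.L R P prm dec q (t ++ (inj₁ s ∷ [])) A (Setup._∙_ R P B (Setup.sElem R P s))
        ≡ Setup.Weights.L R P prm dec q t A B)
    × (Setup.Prec R P B s →
      Setup.Weights.L R P prm dec q (t ++ (inj₁ s ∷ [])) A (Setup._∙_ R P B (Setup.sElem R P s))
        ≡ Setup.Weights.qs R P prm dec q s * Setup.Weights.L R P prm dec q t A B
          + (Setup.Weights.qs R P prm dec q s - + 1)
            * Setup.Weights.L R P prm dec q t A (Setup._∙_ R P B (Setup.sElem R P s)))
lemma5p4 R P prm dec q t s@((i , m) , wall) A B = case-≻ , case-≺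
  where
  open Setup R P using (Prec; sElem; _∙_)
  open Setup.Weights R P prm dec q using (L; qs)
  open Galleries R P prm dec q
  open Alcoves.Wall R P i m wall using (¬prec⇒prec∙s; prec⇒¬prec∙s)
  open ≡-Reasoning
  Bs = B ∙ sElem s

  case-≻ : ¬ Prec B s → L (t ++ inj₁ s ∷ []) A Bs ≡ L t A B
  case-≻ B⊀Bs = begin
    L (t ++ inj₁ s ∷ []) A Bs
      ≡⟨ L-snoc t s A B ⟩
    crossWeight B s * L t A B + foldWeight Bs s * L t A Bs
      ≡⟨ cong₂ (λ c f → c * L t A B + f * L t A Bs) (crossWeight-⊀ B⊀Bs) (foldWeight-≺ (¬prec⇒prec∙s B B⊀Bs)) ⟩
    + 1 * L t A B + + 0 * L t A Bs
      ≡⟨ by-ring (L t A B) (L t A Bs) ⟩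
    L t A B ∎
    where by-ring : ∀ x y → + 1 * x + + 0 * y ≡ x
          by-ring = ℤ-Solver.solve-∀

  case-≺ : Prec B s → L (t ++ inj₁ s ∷ []) A Bs ≡ qs s * L t A B + (qs s - + 1) * L t A Bs
  case-≺ B≺Bs = begin
    L (t ++ inj₁ s ∷ []) A Bs
      ≡⟨ L-snoc t s A B ⟩
    crossWeight B s * L t A B + foldWeight Bs s * L t A Bs
      ≡⟨ cong₂ (λ c f → c * L t A B + f * L t A Bs) (crossWeight-≺ B≺Bs) (foldWeight-⊀ (prec⇒¬prec∙s B B≺Bs)) ⟩
    qs s * L t A B + (qs s - + 1) * L t A Bs ∎
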